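{- Let $\lambda$ and $\lambda'$ be partitions with at most $n$ parts. (i) If $\beta\in U_\lambda(n)$, $\beta'\in U_{\lambda'}(n)$ and $s_\lambda(\beta;x)=s_{\lambda'}(\beta';x)$ as polynomials, then $\lambda=\lambda'$. (ii) If $\pi\in S_n^\lambda$, $\pi'\in S_n^{\lambda'}$ and $d_\lambda(\pi;x)=d_{\lambda'}(\pi';x)$ as polynomials, then $\lambda=\lambda'$ and $\pi=\pi'$; hence $d_\lambda(\pi;x)\equiv d_{\lambda'}(\pi';x)$.
   Context: Fix $n\ge1$, $[n]=\{1,\dots,n\}$, variables $x_1,\dots,x_n$. A partition $\lambda=(\lambda_1\ge\dots\ge\lambda_n\ge0)$; box $(j,i)$ of its shape is in column $j$, row $i$. $R_\lambda\subseteq[n-1]$ is the set of distinct column lengths of $\lambda$ less than $n$, written $q_1<\dots<q_r$, $q_0:=0$, $q_{r+1}:=n$; carrels are $(q_{h-1},q_h]$. $U_\lambda(n)$: $n$-tuples $\beta$ with entries in $[n]$ and $\beta_i\ge i$ for all $i$. $\mathcal{T}_\lambda$: semistandard tableaux of shape $\lambda$ with entries in $[n]$ (strict down columns, weak along rows), ordered entrywise; content $\Theta(T)=(\theta_1,\dots,\theta_n)$ with $\theta_i$ the number of entries equal to $i$; weight $x^{\Theta(T)}=x_1^{\theta_1}\cdots x_n^{\theta_n}$. Row bound set $\mathcal{S}_\lambda(\beta):=\{T\in\mathcal{T}_\lambda:T_j(i)\le\beta_i\text{ for all boxes}\}$; row bound sum $s_\lambda(\beta;x):=\sum_{T\in\mathcal{S}_\lambda(\beta)}x^{\Theta(T)}$.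 $S_n^\lambda$: permutations $\pi$ of $[n]$ increasing on each carrel; $B_h:=\{\pi_1,\dots,\pi_{q_h}\}$. $\lambda$-key $Y_\lambda(\pi)$: the tableau of shape $\lambda$ whose columns of length $q_h$ ($h\in[r]$) have entry set $B_h$ and columns of length $n$ have entry set $[n]$. $\mathcal{D}_\lambda(\pi):=\{T\in\mathcal{T}_\lambda:K_+(T)\le Y_\lambda(\pi)\}$ with $K_+(T)$ the Lascoux–Schützenberger right key of $T$; Demazure polynomial $d_\lambda(\pi;x):=\sum_{T\in\mathcal{D}_\lambda(\pi)}x^{\Theta(T)}$. Two such weight-sum polynomials are identical as generating functions ($\equiv$) if their underlying tableau sets are equal. -}

module Defs where

open import Data.Nat using (ℕ; zero; suc; _+_; _∸_; _≤_; _<_; _≤ᵇ_; _<ᵇ_; _≡ᵇ_; _⊔_)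
open import Data.Nat.Properties using (_≟_)
open import Data.Bool using (Bool; true; false; _∧_; if_then_else_)
open import Data.List using (List; []; _∷_; [_]; map; concatMap; concat; length; filterᵇ;
  reverse; foldl; foldr; applyUpTo; zipWith; take)
open import Data.Bool.ListAction using (and; all)
open import Data.Maybe using (Maybe; just; nothing)
open import Data.Vec using (Vec; toList; lookup; tabulate)
open import Data.Vec.Properties using (≡-dec)
open import Data.Fin using (Fin; toℕ) renaming (_≤_ to _≤ᶠ_)
open import Data.Product using (Σ; _×_; _,_)
open import Relation.Nullary using (¬_)
open import Relation.Nullary.Decidable using (⌊_⌋)
open import Relation.Binary.PropositionalEquality using (_≡_)

-- Everything is 1-indexed as in the paper: entries of
-- tableaux, of β and of π are natural numbers in [n] = {1,…,n}.
-- A vector  v : Vec ℕ n  is the n-tuple (v₁,…,vₙ) with vᵢ = lookup v (i-1).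

IsPartition : {n : ℕ} → Vec ℕ n → Set
IsPartition {n} lam = ∀ (i j : Fin n) → i ≤ᶠ j → lookup lam j ≤ lookup lam i

range : ℕ → List ℕ
range n = applyUpTo suc n

-- Fillings / tableaux.  A filling is its list of rows (top row first);
-- row i is the list (T₁(i), T₂(i), …) of its entries left to right.
Filling : Set
Filling = List (List ℕ)

words : ℕ → ℕ → List (List ℕ)
words n zero    = [ [] ]
words n (suc k) = concatMap (λ a → map (a ∷_) (words n k)) (range n)

fillings : ℕ → List ℕ → List Filling
fillings n []       = [ [] ]
fillings n (l ∷ ls) = concatMap (λ r → map (r ∷_) (fillings n ls)) (words n l)

weaklyIncreasing : List ℕ → Bool
weaklyIncreasing []           = true
weaklyIncreasing (a ∷ [])     = true
weaklyIncreasing (a ∷ b ∷ xs) = (a ≤ᵇ b) ∧ weaklyIncreasing (b ∷ xs)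

strictlyBelow : List ℕ → List ℕ → Bool
strictlyBelow up low = and (zipWith _<ᵇ_ up low)

columnsStrict : Filling → Bool
columnsStrict []               = true
columnsStrict (r ∷ [])         = true
columnsStrict (r ∷ r' ∷ rs)    = strictlyBelow r r' ∧ columnsStrict (r' ∷ rs)

isSSYT : Filling → Bool
isSSYT T = all weaklyIncreasing T ∧ columnsStrict T

𝒯 : (n : ℕ) → Vec ℕ n → List Filling
𝒯 n lam = filterᵇ isSSYT (fillings n (toList lam))

count : ℕ → List ℕ → ℕ
count a xs = length (filterᵇ (a ≡ᵇ_) xs)

content : (n : ℕ) → Filling → Vec ℕ n
content n T = tabulate (λ i → count (suc (toℕ i)) (concat T))

-- Polynomials in x₁,…,xₙ with ℕ coefficients, as coefficient functions
-- (exponent vector ↦ coefficient).  The weight generating function of a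
-- finite list S of tableaux is  Σ_{T ∈ S} x^{Θ(T)}.
Poly : ℕ → Set
Poly n = Vec ℕ n → ℕ

weightSum : (n : ℕ) → List Filling → Poly n
weightSum n S θ = length (filterᵇ (λ T → ⌊ ≡-dec _≟_ (content n T) θ ⌋) S)

_≈ₚ_ : {n : ℕ} → Poly n → Poly n → Set
_≈ₚ_ {n} f g = ∀ (θ : Vec ℕ n) → f θ ≡ g θ

InU : (n : ℕ) → Vec ℕ n → Set
InU n β = ∀ (i : Fin n) → (suc (toℕ i) ≤ lookup β i) × (lookup β i ≤ n)

rowBounded : List ℕ → Filling → Bool
rowBounded β T = and (zipWith (λ b r → all (_≤ᵇ b) r) β T)

rowBoundSet : (n : ℕ) → Vec ℕ n → Vec ℕ n → List Filling
rowBoundSet n lam β = filterᵇ (rowBounded (toList β)) (𝒯 n lam)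

s : (n : ℕ) → Vec ℕ n → Vec ℕ n → Poly n
s n lam β = weightSum n (rowBoundSet n lam β)

-- length of column j (j ≥ 1) of the shape λ : #{ i : λᵢ ≥ j }
colLength : {n : ℕ} → Vec ℕ n → ℕ → ℕ
colLength lam j = length (filterᵇ (j ≤ᵇ_) (toList lam))

numCols : {n : ℕ} → Vec ℕ n → ℕ
numCols lam = foldr _⊔_ 0 (toList lam)

InR : {n : ℕ} → Vec ℕ n → ℕ → Set
InR {n} lam q = (1 ≤ q) × (q < n) × Σ ℕ (λ j → (1 ≤ j) × (colLength lam j ≡ q))

-- π = (π₁,…,πₙ) (one-line notation) is a permutation of [n]
IsPerm : (n : ℕ) → Vec ℕ n → Set
IsPerm n π = (∀ (i : Fin n) → (1 ≤ lookup π i) × (lookup π i ≤ n))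
           × (∀ (i j : Fin n) → lookup π i ≡ lookup π j → i ≡ j)

-- π ∈ S_n^λ : π increasing on each carrel (q_{h-1}, q_h], i.e.
-- π_p < π_{p+1} whenever p, p+1 lie in the same carrel, i.e. p ∉ R_λ.
InS : (n : ℕ) → Vec ℕ n → Vec ℕ n → Set
InS n lam π = IsPerm n π
  × (∀ (i j : Fin n) → toℕ j ≡ suc (toℕ i) → ¬ InR lam (suc (toℕ i))
       → lookup π i < lookup π j)

-- insertion sort (columns of keys are listed top to bottom, increasing)
insert : ℕ → List ℕ → List ℕ
insert a []       = a ∷ []
insert a (b ∷ bs) = if a ≤ᵇ b then a ∷ b ∷ bs else b ∷ insert a bs

isort : List ℕ → List ℕ
isort = foldr insert []

-- column j (0-based position, i.e. the (j+1)-th column) of the λ-key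
-- Y_λ(π): its entry set is {π₁,…,π_c}, c its length (this is B_h when
-- c = q_h, and [n] when c = n).
keyColumn : {n : ℕ} → Vec ℕ n → Vec ℕ n → ℕ → List ℕ
keyColumn lam π j = isort (take (colLength lam (suc j)) (toList π))

rowInsert : ℕ → List ℕ → List ℕ × Maybe ℕ
rowInsert a []       = a ∷ [] , nothing
rowInsert a (b ∷ bs) with a <ᵇ b
... | true  = a ∷ bs , just b
... | false with rowInsert a bs
...   | r , m = b ∷ r , m

insertP : ℕ → List (List ℕ) → List (List ℕ)
insertP a []       = (a ∷ []) ∷ []
insertP a (r ∷ rs) with rowInsert a r
... | r' , nothing = r' ∷ rs
... | r' , just b  = r' ∷ insertP b rs

P : List ℕ → List (List ℕ)
P w = foldl (λ t a → insertP a t) [] w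

nth : List ℕ → ℕ → Maybe ℕ
nth []       k       = nothing
nth (x ∷ xs) zero    = just x
nth (x ∷ xs) (suc k) = nth xs k

maybeList : Maybe ℕ → List ℕ
maybeList (just x) = x ∷ []
maybeList nothing  = []

-- column j (0-based) of a filling, top to bottom
column : ℕ → Filling → List ℕ
column j T = concatMap (λ r → maybeList (nth r j)) T

width : Filling → ℕ
width []      = 0
width (r ∷ _) = length r

colWordFrom : Filling → ℕ → List ℕ
colWordFrom T j = concatMap (λ k → reverse (column k T)) (applyUpTo (j +_) (width T ∸ j))

firstColumn : List (List ℕ) → List ℕ
firstColumn t = concatMap (λ r → maybeList (nth r 0)) t

-- column j (0-based) of K₊(T): the last column of the (unique) skew
-- tableau of anti-normal shape Knuth equivalent to the columns j,j+1,…
-- of T.  It is computed via the 180°-rotation/complement  w* : reverse w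
-- and replace a by n+1-a, which commutes with Knuth equivalence and
-- exchanges rectification and anti-rectification:  the last column of
-- the anti-rectification of w is { n+1-a : a ∈ first column of P(w*) }.
rightKeyColumn : ℕ → Filling → ℕ → List ℕ
rightKeyColumn n T j =
  isort (map (suc n ∸_) (firstColumn (P (map (suc n ∸_) (reverse (colWordFrom T j))))))

leqList : List ℕ → List ℕ → Bool
leqList xs ys = and (zipWith _≤ᵇ_ xs ys)

rightKeyBelow : (n : ℕ) → Vec ℕ n → Vec ℕ n → Filling → Bool
rightKeyBelow n lam π T =
  and (map (λ j → leqList (rightKeyColumn n T j) (keyColumn lam π j)) (applyUpTo (λ k → k) (numCols lam)))

demazureSet : (n : ℕ) → Vec ℕ n → Vec ℕ n → List Filling
demazureSet n lam π = filterᵇ (rightKeyBelow n lam π) (𝒯 n lam)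

d : (n : ℕ) → Vec ℕ n → Vec ℕ n → Poly n
d n lam π = weightSum n (demazureSet n lam π)

{-# OPTIONS --safe #-}
-- The superstandard tableau of shape λ (row i filled with i) has weight x^λ and
-- lies in every 𝒮_λ(β) and every 𝒟_λ(π).  In a semistandard tableau of shape μ
-- the entries ≤ k fill at most the first k rows, so a tableau of shape μ and
-- weight x^λ forces λ ⊴ μ in dominance order.  Equal polynomials thus give
-- λ ⊴ λ' and λ' ⊴ λ, that is λ = λ'.
--
-- For (ii), the key Y_λ(π) is its own right key, so it lies in 𝒟_λ(π).  A tableau
-- of shape λ with the content of a key is that key, hence d_λ(π) = d_λ(π') puts
-- Y_λ(π) into 𝒟_λ(π'): Y_λ(π) ≤ Y_λ(π'), and symmetrically.  Equal keys have equal
-- sets B_h, and a permutation increasing on the carrels is determined by them.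

module Submission where

open import Defs
open import Data.Bool using (true; false; _∧_; T?) renaming (T to True)
open import Data.Bool.Properties using (T-∧)
open import Data.Bool.ListAction using (and; all)
open import Data.Empty using (⊥; ⊥-elim)
open import Data.Fin using (Fin; toℕ; fromℕ<) renaming (zero to fzero; suc to fsuc)
open import Data.Fin.Properties using (toℕ-fromℕ<) renaming (suc-injective to fsuc-injective)
open import Data.List
  using (List; []; _∷_; _++_; [_]; length; reverse; map; foldl; foldr; concat; concatMap; filterᵇ; applyUpTo; replicate; take)
open import Data.List.Properties
  using ( length-++; length-++-sucʳ; length-reverse; length-applyUpTo; length-take; length-filter; unfold-reverse; reverse-++
        ; reverse-involutive; reverse-map; ++-assoc; map-++; map-cong-local; foldl-++
        ; filter-++; filter-accept; filter-reject; filter-none; filter-some)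
open import Data.List.Membership.Propositional using (_∈_; _∉_; find; lose)
open import Data.List.Membership.Propositional.Properties
  using (∈-∃++; ∈-++⁻; ∈-++⁺ˡ; ∈-++⁺ʳ; ∈-map⁺; ∈-map⁻; ∈-concatMap⁺; ∈-concatMap⁻; ∈-applyUpTo⁺; ∈-applyUpTo⁻; ∈-filter⁺; ∈-filter⁻)
open import Data.List.Relation.Binary.Subset.Propositional using (_⊆_)
open import Data.List.Relation.Binary.Subset.Propositional.Properties using (⊆-refl; ⊆-trans)
open import Data.List.Relation.Unary.All as All using (All; []; _∷_)
import Data.List.Relation.Unary.All.Properties as Allₚ
open import Data.List.Relation.Unary.Any as Any using (here; there)
import Data.List.Relation.Unary.Any.Properties as Anyₚ
open import Data.List.Relation.Unary.AllPairs as AllPairs using (AllPairs; []; _∷_)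
import Data.List.Relation.Unary.AllPairs.Properties as AllPairsₚ
open import Data.List.Relation.Unary.Linked using (Linked; []; [-]; _∷_)
open import Data.List.Relation.Unary.Linked.Properties using (Linked⇒AllPairs)
open import Data.List.Relation.Unary.Unique.Propositional using (Unique)
import Data.List.Relation.Unary.Unique.Propositional.Properties as Uniqueₚ
open import Data.Maybe using (just; nothing)
open import Data.Nat using (ℕ; zero; suc; _+_; _∸_; _≤_; _<_; _>_; _≥_; _≤ᵇ_; _<ᵇ_; _≡ᵇ_; _⊔_; _⊓_; z≤n; s≤s)
open import Data.Nat.ListAction using (sum)
open import Data.Nat.Properties
open import Algebra.Properties.CommutativeSemigroup +-commutativeSemigroup using (interchange)
open import Data.List.Membership.DecPropositional _≟_ using (_∈?_)
open import Data.Product as Product using (∃; _×_; _,_; proj₁; proj₂)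
open import Data.Sum using (_⊎_; inj₁; inj₂; [_,_]′)
open import Data.Unit using (⊤; tt)
open import Data.Vec using (Vec; toList; lookup; tabulate) renaming ([] to []ᵥ; _∷_ to _∷ᵥ_)
open import Data.Vec.Properties
  using (≡-dec; tabulate-cong; tabulate∘lookup; lookup∘tabulate; length-toList; toList-injective; cast-is-id)
open import Function using (flip; _∘′_)
open import Function.Bundles using (Equivalence)
open import Relation.Binary.PropositionalEquality
  using (_≡_; _≢_; refl; sym; trans; cong; cong₂; subst; subst₂; module ≡-Reasoning)
open import Relation.Nullary using (¬_; yes; no)
open import Relation.Nullary.Decidable using (⌊_⌋; fromWitness; toWitness)
open import Relation.Nullary.Reflects using (ofʸ; ofⁿ)

-- Increasing lists and insertion sort

head-≤-∈ : ∀ {x y ys} → AllPairs _<_ (y ∷ ys) → x ∈ y ∷ ys → y ≤ x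
head-≤-∈ _ (here refl) = ≤-refl
head-≤-∈ (y<ys ∷ _) (there x∈ys) = <⇒≤ (All.lookup y<ys x∈ys)

⊆-tail : ∀ {x xs y ys} → AllPairs _<_ (x ∷ xs) → AllPairs _<_ (y ∷ ys) → x ∷ xs ⊆ y ∷ ys → xs ⊆ ys
⊆-tail (x<xs ∷ _) y∷ys↑ sub z∈xs =
  Any.tail (λ z≡y → <-irrefl (sym z≡y) (≤-<-trans (head-≤-∈ y∷ys↑ (sub (here refl))) (All.lookup x<xs z∈xs)))
           (sub (there z∈xs))

reverse-allPairs : ∀ {R : ℕ → ℕ → Set} {xs} → AllPairs R xs → AllPairs (flip R) (reverse xs)
reverse-allPairs {xs = []} [] = []
reverse-allPairs {R} {x ∷ xs} (x∼xs ∷ xs∼) =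
  subst (AllPairs (flip R)) (sym (unfold-reverse x xs))
    (AllPairsₚ.++⁺ (reverse-allPairs xs∼) ([] ∷ [])
      (All.tabulate (λ y∈ → All.lookup x∼xs (Anyₚ.reverse⁻ y∈) ∷ [])))

increasing⇒unique : ∀ {xs} → AllPairs _<_ xs → Unique xs
increasing⇒unique = AllPairs.map <⇒≢

∈-++-∷-remove : ∀ {z x : ℕ} us {vs} → z ∈ us ++ x ∷ vs → z ≢ x → z ∈ us ++ vs
∈-++-∷-remove us z∈ z≢x with ∈-++⁻ us z∈
... | inj₁ z∈us = ∈-++⁺ˡ z∈us
... | inj₂ z∈x∷vs = ∈-++⁺ʳ us (Any.tail z≢x z∈x∷vs)

unique-⊆⇒length-≤ : ∀ {xs ys : List ℕ} → Unique xs → xs ⊆ ys → length xs ≤ length ys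
unique-⊆⇒length-≤ {[]} _ _ = z≤n
unique-⊆⇒length-≤ {x ∷ xs} (x≢xs ∷ xs!) sub with ∈-∃++ (sub (here refl))
... | us , vs , refl =
  subst (suc (length xs) ≤_) (sym (length-++-sucʳ us x vs)) (s≤s (unique-⊆⇒length-≤ xs! xs⊆us++vs))
  where
    xs⊆us++vs : xs ⊆ us ++ vs
    xs⊆us++vs z∈xs = ∈-++-∷-remove us (sub (there z∈xs)) (λ z≡x → All.lookup x≢xs z∈xs (sym z≡x))

increasing-⊆-length⇒≡ : ∀ {xs ys} → AllPairs _<_ xs → AllPairs _<_ ys → xs ⊆ ys → length ys ≤ length xs → xs ≡ ys
increasing-⊆-length⇒≡ {[]} {[]} _ _ _ _ = refl
increasing-⊆-length⇒≡ {x ∷ xs} {[]} _ _ sub _ with sub (here refl)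
... | ()
increasing-⊆-length⇒≡ {x ∷ xs} {y ∷ ys} xs↑ ys↑ sub (s≤s ys≤xs) with sub (here refl)
... | here refl = cong (x ∷_) (increasing-⊆-length⇒≡ (AllPairs.tail xs↑) (AllPairs.tail ys↑) (⊆-tail xs↑ ys↑ sub) ys≤xs)
... | there x∈ys = ⊥-elim (<-irrefl refl (≤-trans (unique-⊆⇒length-≤ (increasing⇒unique xs↑) x∷xs⊆ys) ys≤xs))
  where
    x∷xs⊆ys : x ∷ xs ⊆ ys
    x∷xs⊆ys z∈ = Any.tail (λ z≡y → <-irrefl (sym z≡y) (<-≤-trans (All.lookup (AllPairs.head ys↑) x∈ys) (head-≤-∈ xs↑ z∈)))
                          (sub z∈)

insert⁺ : ∀ {P : ℕ → Set} {a ys} → P a → All P ys → All P (insert a ys)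
insert⁺ {a = a} {[]} pa [] = pa ∷ []
insert⁺ {a = a} {b ∷ bs} pa (pb ∷ pbs) with a ≤ᵇ b
... | true = pa ∷ pb ∷ pbs
... | false = pb ∷ insert⁺ pa pbs

∈-insert⁻ : ∀ {x} a ys → x ∈ insert a ys → x ≡ a ⊎ x ∈ ys
∈-insert⁻ a [] (here x≡a) = inj₁ x≡a
∈-insert⁻ a (b ∷ bs) x∈ with a ≤ᵇ b | x∈
... | true  | here x≡a = inj₁ x≡a
... | true  | there x∈bs = inj₂ x∈bs
... | false | here x≡b = inj₂ (here x≡b)
... | false | there x∈ = [ inj₁ , inj₂ ∘′ there ]′ (∈-insert⁻ a bs x∈)

∈-insert⁺ˡ : ∀ a ys → a ∈ insert a ys
∈-insert⁺ˡ a [] = here refl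
∈-insert⁺ˡ a (b ∷ bs) with a ≤ᵇ b
... | true = here refl
... | false = there (∈-insert⁺ˡ a bs)

∈-insert⁺ʳ : ∀ {x} a ys → x ∈ ys → x ∈ insert a ys
∈-insert⁺ʳ a (b ∷ bs) x∈ with a ≤ᵇ b | x∈
... | true  | _ = there x∈
... | false | here x≡b = here x≡b
... | false | there x∈bs = there (∈-insert⁺ʳ a bs x∈bs)

length-insert : ∀ a ys → length (insert a ys) ≡ suc (length ys)
length-insert a [] = refl
length-insert a (b ∷ bs) with a ≤ᵇ b
... | true = refl
... | false = cong suc (length-insert a bs)

insert-increasing : ∀ a {ys} → a ∉ ys → AllPairs _<_ ys → AllPairs _<_ (insert a ys)
insert-increasing a {[]} _ [] = [] ∷ []
insert-increasing a {b ∷ bs} a∉ (b<bs ∷ bs↑) with a ≤ᵇ b | ≤ᵇ-reflects-≤ a b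
... | true | ofʸ a≤b = (a<b ∷ All.map (<-trans a<b) b<bs) ∷ b<bs ∷ bs↑
  where
    a<b : a < b
    a<b = ≤∧≢⇒< a≤b (λ a≡b → a∉ (here a≡b))
... | false | ofⁿ a≰b = insert⁺ (≰⇒> a≰b) b<bs ∷ insert-increasing a (λ a∈bs → a∉ (there a∈bs)) bs↑

∈-isort⁻ : ∀ {x} xs → x ∈ isort xs → x ∈ xs
∈-isort⁻ (y ∷ ys) x∈ = [ (λ x≡y → here x≡y) , (λ x∈ys → there (∈-isort⁻ ys x∈ys)) ]′ (∈-insert⁻ y (isort ys) x∈)

∈-isort⁺ : ∀ {x} xs → x ∈ xs → x ∈ isort xs
∈-isort⁺ (y ∷ ys) (here refl) = ∈-insert⁺ˡ y (isort ys)
∈-isort⁺ (y ∷ ys) (there x∈ys) = ∈-insert⁺ʳ y (isort ys) (∈-isort⁺ ys x∈ys)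

length-isort : ∀ xs → length (isort xs) ≡ length xs
length-isort [] = refl
length-isort (y ∷ ys) = trans (length-insert y (isort ys)) (cong suc (length-isort ys))

isort-increasing : ∀ {xs} → Unique xs → AllPairs _<_ (isort xs)
isort-increasing {[]} [] = []
isort-increasing {y ∷ ys} (y≢ys ∷ ys!) =
  insert-increasing y (λ y∈ → All.lookup y≢ys (∈-isort⁻ ys y∈) refl) (isort-increasing ys!)

isort-reverse : ∀ {xs} → AllPairs _<_ xs → isort (reverse xs) ≡ xs
isort-reverse {xs} xs↑ =
  increasing-⊆-length⇒≡ (isort-increasing (AllPairs.map >⇒≢ (reverse-allPairs xs↑))) xs↑
    (λ x∈ → Anyₚ.reverse⁻ (∈-isort⁻ (reverse xs) x∈))
    (≤-reflexive (sym (trans (length-isort (reverse xs)) (length-reverse xs))))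

-- Indexing with the junk value 0 beyond the end of the list.
at : List ℕ → ℕ → ℕ
at [] _ = 0
at (x ∷ xs) zero = x
at (x ∷ xs) (suc i) = at xs i

at-applyUpTo : ∀ (f : ℕ → ℕ) {c i} → i < c → at (applyUpTo f c) i ≡ f i
at-applyUpTo f {suc c} {zero} _ = refl
at-applyUpTo f {suc c} {suc i} (s≤s i<c) = at-applyUpTo (f ∘′ suc) i<c

applyUpTo-at : ∀ xs → applyUpTo (at xs) (length xs) ≡ xs
applyUpTo-at [] = refl
applyUpTo-at (x ∷ xs) = cong (x ∷_) (applyUpTo-at xs)

applyUpTo-cong : ∀ {f g : ℕ → ℕ} c → (∀ {i} → i < c → f i ≡ g i) → applyUpTo f c ≡ applyUpTo g c
applyUpTo-cong zero _ = refl
applyUpTo-cong (suc c) f≗g = cong₂ _∷_ (f≗g (s≤s z≤n)) (applyUpTo-cong c (λ i<c → f≗g (s≤s i<c)))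

at-∈ : ∀ xs {i} → i < length xs → at xs i ∈ xs
at-∈ (x ∷ xs) {zero} _ = here refl
at-∈ (x ∷ xs) {suc i} (s≤s i<) = there (at-∈ xs i<)

∈⇒at : ∀ {x} xs → x ∈ xs → ∃ λ i → i < length xs × at xs i ≡ x
∈⇒at (y ∷ ys) (here refl) = 0 , s≤s z≤n , refl
∈⇒at (y ∷ ys) (there x∈) with ∈⇒at ys x∈
... | i , i< , eq = suc i , s≤s i< , eq

at-ext : ∀ xs ys → length xs ≡ length ys → (∀ {i} → i < length xs → at xs i ≡ at ys i) → xs ≡ ys
at-ext [] [] _ _ = refl
at-ext (x ∷ xs) (y ∷ ys) len eq =
  cong₂ _∷_ (eq (s≤s z≤n)) (at-ext xs ys (suc-injective len) (λ i< → eq (s≤s i<)))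

increasing-at-suc : ∀ {xs} i → AllPairs _<_ xs → suc i < length xs → at xs i < at xs (suc i)
increasing-at-suc {x ∷ []} zero _ (s≤s ())
increasing-at-suc {x ∷ y ∷ xs} zero ((x<y ∷ _) ∷ _) _ = x<y
increasing-at-suc (suc i) (_ ∷ xs↑) (s≤s i<) = increasing-at-suc i xs↑ i<

⊆⇒at-≤ : ∀ {xs ys} i → AllPairs _<_ xs → AllPairs _<_ ys → xs ⊆ ys → i < length xs → at ys i ≤ at xs i
⊆⇒at-≤ {[]} _ _ _ _ ()
⊆⇒at-≤ {x ∷ xs} {[]} _ _ _ sub _ with sub (here refl)
... | ()
⊆⇒at-≤ {x ∷ xs} {y ∷ ys} zero _ ys↑ sub _ = head-≤-∈ ys↑ (sub (here refl))
⊆⇒at-≤ {x ∷ xs} {y ∷ ys} (suc i) xs↑ ys↑ sub (s≤s i<) =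
  ⊆⇒at-≤ i (AllPairs.tail xs↑) (AllPairs.tail ys↑) (⊆-tail xs↑ ys↑ sub) i<

∈-take⁻ : ∀ {x : ℕ} t xs → x ∈ take t xs → x ∈ xs
∈-take⁻ (suc t) (y ∷ ys) (here x≡y) = here x≡y
∈-take⁻ (suc t) (y ∷ ys) (there x∈) = there (∈-take⁻ t ys x∈)

take-⊆-take : ∀ {s t} (xs : List ℕ) → s ≤ t → take s xs ⊆ take t xs
take-⊆-take {suc s} {suc t} (y ∷ ys) _ (here x≡y) = here x≡y
take-⊆-take {suc s} {suc t} (y ∷ ys) (s≤s s≤t) (there x∈) = there (take-⊆-take ys s≤t x∈)

∈-take⇒at : ∀ {x} t xs → x ∈ take t xs → ∃ λ i → i < t × at xs i ≡ x
∈-take⇒at (suc t) (y ∷ ys) (here refl) = 0 , s≤s z≤n , refl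
∈-take⇒at (suc t) (y ∷ ys) (there x∈) with ∈-take⇒at t ys x∈
... | i , i<t , eq = suc i , s≤s i<t , eq

at-∈-take : ∀ {t i} xs → i < t → i < length xs → at xs i ∈ take t xs
at-∈-take {suc t} {zero} (y ∷ ys) _ _ = here refl
at-∈-take {suc t} {suc i} (y ∷ ys) (s≤s i<t) (s≤s i<) = there (at-∈-take ys i<t i<)

unique⇒at-injective : ∀ {xs} → Unique xs → ∀ {i j} → i < length xs → j < length xs → at xs i ≡ at xs j → i ≡ j
unique⇒at-injective {x ∷ xs} _ {zero} {zero} _ _ _ = refl
unique⇒at-injective {x ∷ xs} (x≢xs ∷ _) {zero} {suc j} _ (s≤s j<) eq = ⊥-elim (All.lookup x≢xs (at-∈ xs j<) eq)
unique⇒at-injective {x ∷ xs} (x≢xs ∷ _) {suc i} {zero} (s≤s i<) _ eq = ⊥-elim (All.lookup x≢xs (at-∈ xs i<) (sym eq))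
unique⇒at-injective {x ∷ xs} (_ ∷ xs!) {suc i} {suc j} (s≤s i<) (s≤s j<) eq = cong suc (unique⇒at-injective xs! i< j< eq)

-- Schensted insertion of columns

insertWord : List (List ℕ) → List ℕ → List (List ℕ)
insertWord = foldl (λ t a → insertP a t)

rowInsertWord : List ℕ → List ℕ → List ℕ × List ℕ
rowInsertWord [] r = r , []
rowInsertWord (a ∷ as) r =
  Product.map₂ (maybeList (proj₂ (rowInsert a r)) ++_) (rowInsertWord as (proj₁ (rowInsert a r)))

insertWord-∷ : ∀ ws R Rs →
  insertWord (R ∷ Rs) ws ≡ proj₁ (rowInsertWord ws R) ∷ insertWord Rs (proj₂ (rowInsertWord ws R))
insertWord-∷ [] R Rs = refl
insertWord-∷ (a ∷ ws) R Rs with rowInsert a R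
... | R₁ , nothing = insertWord-∷ ws R₁ Rs
... | R₁ , just b = insertWord-∷ ws R₁ (insertP b Rs)

rowInsertWord-++ : ∀ xs ys R →
  rowInsertWord (xs ++ ys) R
    ≡ Product.map₂ (proj₂ (rowInsertWord xs R) ++_) (rowInsertWord ys (proj₁ (rowInsertWord xs R)))
rowInsertWord-++ [] ys R = refl
rowInsertWord-++ (a ∷ xs) ys R =
  trans (cong (Product.map₂ (bumped ++_)) (rowInsertWord-++ xs ys R₁))
        (cong (proj₁ rest ,_) (sym (++-assoc bumped (proj₂ (rowInsertWord xs R₁)) (proj₂ rest))))
  where
    R₁ = proj₁ (rowInsert a R)
    bumped = maybeList (proj₂ (rowInsert a R))
    rest = rowInsertWord ys (proj₁ (rowInsertWord xs R₁))

rowInsert-++ˡ : ∀ {a} A R → All (_≤ a) A → rowInsert a (A ++ R) ≡ Product.map₁ (A ++_) (rowInsert a R)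
rowInsert-++ˡ [] R _ = refl
rowInsert-++ˡ {a} (b ∷ A) R (b≤a ∷ A≤a) with a <ᵇ b | <ᵇ-reflects-< a b
... | true  | ofʸ a<b = ⊥-elim (<⇒≱ a<b b≤a)
... | false | _ rewrite rowInsert-++ˡ A R A≤a = refl

rowInsertWord-++ˡ : ∀ ws A R → All (λ w → All (_≤ w) A) ws →
  rowInsertWord ws (A ++ R) ≡ Product.map₁ (A ++_) (rowInsertWord ws R)
rowInsertWord-++ˡ [] A R _ = refl
rowInsertWord-++ˡ (a ∷ ws) A R (A≤a ∷ A≤ws)
  rewrite rowInsert-++ˡ A R A≤a | rowInsertWord-++ˡ ws A (proj₁ (rowInsert a R)) A≤ws = refl

rowInsert-bump : ∀ {a b} B → a < b → rowInsert a (b ∷ B) ≡ (a ∷ B , just b)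
rowInsert-bump {a} {b} B a<b with a <ᵇ b | <ᵇ-reflects-< a b
... | true  | _ = refl
... | false | ofⁿ a≮b = ⊥-elim (a≮b a<b)

replicate-++-∷ : ∀ m (e : ℕ) X → replicate m e ++ e ∷ X ≡ e ∷ replicate m e ++ X
replicate-++-∷ zero e X = refl
replicate-++-∷ (suc m) e X = cong (e ∷_) (replicate-++-∷ m e X)

RowOver : List ℕ → List ℕ → Set
RowOver es R = AllPairs _≤_ R × R ⊆ es

rowOver-split : ∀ {e es R} → AllPairs _<_ (e ∷ es) → RowOver (e ∷ es) R →
  ∃ λ m → ∃ λ R' → R ≡ replicate m e ++ R' × RowOver es R'
rowOver-split {R = []} _ _ = 0 , [] , refl , [] , λ ()
rowOver-split {e} {es} {r ∷ R} e∷es↑ (r≤R ∷ R↗ , r∷R⊆) with r∷R⊆ (here refl)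
... | here refl with rowOver-split e∷es↑ (R↗ , r∷R⊆ ∘′ there)
...   | m , R' , refl , R'-over = suc m , R' , refl , R'-over
rowOver-split {e} {es} {r ∷ R} (e<es ∷ _) (r≤R ∷ R↗ , r∷R⊆) | there r∈es =
  0 , r ∷ R , refl , (r≤R ∷ R↗) , r∷R⊆es
  where
    r≤ : ∀ {z} → z ∈ r ∷ R → r ≤ z
    r≤ (here refl) = ≤-refl
    r≤ (there z∈R) = All.lookup r≤R z∈R
    r∷R⊆es : r ∷ R ⊆ es
    r∷R⊆es z∈ = Any.tail (λ z≡e → <-irrefl (sym z≡e) (<-≤-trans (All.lookup e<es r∈es) (r≤ z∈))) (r∷R⊆ z∈)

rowInsertWord-column : ∀ {e es R} → AllPairs _<_ (e ∷ es) → RowOver (e ∷ es) R →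
  rowInsertWord (reverse (e ∷ es)) R ≡ (e ∷ R , reverse es)
rowInsertWord-column {e} {[]} e↑ over with rowOver-split e↑ over
... | m , [] , refl , _
  rewrite rowInsert-++ˡ (replicate m e) [] (Allₚ.replicate⁺ m ≤-refl) = cong (_, []) (replicate-++-∷ m e [])
... | m , x ∷ _ , refl , (_ , x∷⊆[]) with x∷⊆[] (here refl)
...   | ()
rowInsertWord-column {e} {e₂ ∷ es} e∷es↑@((e<e₂ ∷ e<es) ∷ _) over with rowOver-split e∷es↑ over
... | m , R' , refl , R'-over
  rewrite unfold-reverse e (e₂ ∷ es)
        | rowInsertWord-++ (reverse (e₂ ∷ es)) [ e ] (replicate m e ++ R')
        | rowInsertWord-++ˡ (reverse (e₂ ∷ es)) (replicate m e) R'
            (All.tabulate (λ w∈ → Allₚ.replicate⁺ m (<⇒≤ (All.lookup (e<e₂ ∷ e<es) (Anyₚ.reverse⁻ w∈)))))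
        | rowInsertWord-column (AllPairs.tail e∷es↑) R'-over
        | rowInsert-++ˡ (replicate m e) (e₂ ∷ R') (Allₚ.replicate⁺ m ≤-refl)
        | rowInsert-bump R' e<e₂
  = cong₂ _,_ (replicate-++-∷ m e R') (sym (unfold-reverse e₂ es))

prependColumn : List ℕ → List (List ℕ) → List (List ℕ)
prependColumn [] Rs = Rs
prependColumn (e ∷ es) [] = [ e ] ∷ prependColumn es []
prependColumn (e ∷ es) (R ∷ Rs) = (e ∷ R) ∷ prependColumn es Rs

FitsLeftOf : List ℕ → List (List ℕ) → Set
FitsLeftOf es [] = ⊤
FitsLeftOf [] (R ∷ Rs) = ⊥
FitsLeftOf (e ∷ es) (R ∷ Rs) = RowOver (e ∷ es) R × FitsLeftOf es Rs

insertWord-[]-∷ʳ : ∀ xs e → insertWord [] (xs ++ [ e ]) ≡ insertWord [ [] ] (xs ++ [ e ])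
insertWord-[]-∷ʳ [] e = refl
insertWord-[]-∷ʳ (x ∷ xs) e = refl

insertWord-column-∷ : ∀ {e es} R Rs → AllPairs _<_ (e ∷ es) → RowOver (e ∷ es) R →
  insertWord (R ∷ Rs) (reverse (e ∷ es)) ≡ (e ∷ R) ∷ insertWord Rs (reverse es)
insertWord-column-∷ {e} {es} R Rs e∷es↑ over =
  trans (insertWord-∷ (reverse (e ∷ es)) R Rs)
        (cong (λ p → proj₁ p ∷ insertWord Rs (proj₂ p)) (rowInsertWord-column e∷es↑ over))

insertWord-column : ∀ {es Rs} → AllPairs _<_ es → FitsLeftOf es Rs → insertWord Rs (reverse es) ≡ prependColumn es Rs
insertWord-column {[]} {[]} _ _ = refl
insertWord-column {e ∷ es} {[]} e∷es↑ _ =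
  begin
    insertWord [] (reverse (e ∷ es))
  ≡⟨ subst (λ w → insertWord [] w ≡ insertWord [ [] ] w) (sym (unfold-reverse e es)) (insertWord-[]-∷ʳ (reverse es) e) ⟩
    insertWord [ [] ] (reverse (e ∷ es))
  ≡⟨ insertWord-column-∷ [] [] e∷es↑ ([] , λ ()) ⟩
    [ e ] ∷ insertWord [] (reverse es)
  ≡⟨ cong ([ e ] ∷_) (insertWord-column (AllPairs.tail e∷es↑) tt) ⟩
    [ e ] ∷ prependColumn es []
  ∎
  where open ≡-Reasoning
insertWord-column {e ∷ es} {R ∷ Rs} e∷es↑ (over , fits) =
  trans (insertWord-column-∷ R Rs e∷es↑ over) (cong ((e ∷ R) ∷_) (insertWord-column (AllPairs.tail e∷es↑) fits))

prependColumn-fits : ∀ {D E Rs} → AllPairs _<_ D → AllPairs _<_ E → D ⊆ E → FitsLeftOf D Rs →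
  FitsLeftOf E (prependColumn D Rs)
prependColumn-fits {[]} {Rs = []} _ _ _ _ = tt
prependColumn-fits {d ∷ D} {[]} _ _ D⊆E _ with D⊆E (here refl)
... | ()
prependColumn-fits {d ∷ D} {e ∷ E} {Rs} D↑ E↑ D⊆E fits = glue Rs fits
  where
    tail-fits : ∀ {Rs} → FitsLeftOf D Rs → FitsLeftOf E (prependColumn D Rs)
    tail-fits = prependColumn-fits (AllPairs.tail D↑) (AllPairs.tail E↑) (⊆-tail D↑ E↑ D⊆E)
    glue : ∀ Rs → FitsLeftOf (d ∷ D) Rs → FitsLeftOf (e ∷ E) (prependColumn (d ∷ D) Rs)
    glue [] _ = ([] ∷ [] , λ { (here refl) → D⊆E (here refl) }) , tail-fits {[]} tt
    glue (R ∷ Rs) ((R↗ , R⊆) , fits) =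
      (All.tabulate (λ z∈ → head-≤-∈ D↑ (R⊆ z∈)) ∷ R↗ , λ { (here refl) → D⊆E (here refl) ; (there z∈) → D⊆E (R⊆ z∈) })
      , tail-fits fits

firstColumn-prependColumn : ∀ {es Rs} → FitsLeftOf es Rs → firstColumn (prependColumn es Rs) ≡ es
firstColumn-prependColumn {[]} {[]} _ = refl
firstColumn-prependColumn {e ∷ es} {[]} _ = cong (e ∷_) (firstColumn-prependColumn {es} {[]} tt)
firstColumn-prependColumn {e ∷ es} {R ∷ Rs} (_ , fits) = cong (e ∷_) (firstColumn-prependColumn fits)

complement : ℕ → ℕ → ℕ
complement n a = suc n ∸ a

complement-decreasing : ∀ n {xs} → AllPairs _<_ xs → All (_≤ n) xs → AllPairs _>_ (map (complement n) xs)
complement-decreasing n [] [] = []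
complement-decreasing n (x<xs ∷ xs↑) (_ ∷ xs≤n) =
  Allₚ.map⁺ (All.tabulate (λ y∈ → ∸-monoʳ-< (All.lookup x<xs y∈) (≤-trans (All.lookup xs≤n y∈) (n≤1+n n))))
  ∷ complement-decreasing n xs↑ xs≤n

complement-involutive : ∀ n {xs} → All (_≤ n) xs → map (complement n) (map (complement n) xs) ≡ xs
complement-involutive n [] = refl
complement-involutive n (x≤n ∷ xs≤n) = cong₂ _∷_ (m∸[m∸n]≡n (≤-trans x≤n (n≤1+n n))) (complement-involutive n xs≤n)

-- Rotating by 180° and complementing entries (a ↦ n+1−a) turns the column word
-- of columns j, j+1, … of a tableau with nested columns into the rotated columns,
-- last one first, each read bottom to top; inserting each of them glues it in
-- front as a new first column, so the insertion tableau starts with rotated column j.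
module NestedColumns (n : ℕ) (C : ℕ → List ℕ) (C↑ : ∀ k → AllPairs _<_ (C k))
                     (C≤n : ∀ k → All (_≤ n) (C k)) (C-nested : ∀ k → C (suc k) ⊆ C k) where

  rotated : ℕ → List ℕ
  rotated k = reverse (map (complement n) (C k))

  rotated↑ : ∀ k → AllPairs _<_ (rotated k)
  rotated↑ k = reverse-allPairs (complement-decreasing n (C↑ k) (C≤n k))

  rotated-nested : ∀ k → rotated (suc k) ⊆ rotated k
  rotated-nested k x∈ with ∈-map⁻ (complement n) (Anyₚ.reverse⁻ {xs = map (complement n) (C (suc k))} x∈)
  ... | y , y∈ , refl = Anyₚ.reverse⁺ (∈-map⁺ (complement n) (C-nested k y∈))

  rotatedTableau : ℕ → ℕ → List (List ℕ)
  rotatedTableau j zero = []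
  rotatedTableau j (suc m) = prependColumn (rotated j) (rotatedTableau (suc j) m)

  rotatedTableau-fits : ∀ j m {E} → AllPairs _<_ E → rotated j ⊆ E → FitsLeftOf E (rotatedTableau j m)
  rotatedTableau-fits j zero _ _ = tt
  rotatedTableau-fits j (suc m) E↑ sub =
    prependColumn-fits (rotated↑ j) E↑ sub (rotatedTableau-fits (suc j) m (rotated↑ j) (rotated-nested j))

  readingWord : ℕ → ℕ → List ℕ
  readingWord j m = concatMap (λ k → reverse (C k)) (applyUpTo (j +_) m)

  readingWord-suc : ∀ j m → readingWord j (suc m) ≡ reverse (C j) ++ readingWord (suc j) m
  readingWord-suc j m =
    cong₂ (λ k ks → reverse (C k) ++ concatMap (λ k → reverse (C k)) ks)
          (+-identityʳ j) (applyUpTo-cong m (λ _ → +-suc j _))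

  rotatedWord : ℕ → ℕ → List ℕ
  rotatedWord j m = map (complement n) (reverse (readingWord j m))

  rotatedWord-suc : ∀ j m → rotatedWord j (suc m) ≡ rotatedWord (suc j) m ++ reverse (rotated j)
  rotatedWord-suc j m =
    begin
      map (complement n) (reverse (readingWord j (suc m)))
    ≡⟨ cong (map (complement n) ∘′ reverse) (readingWord-suc j m) ⟩
      map (complement n) (reverse (reverse (C j) ++ readingWord (suc j) m))
    ≡⟨ cong (map (complement n)) (reverse-++ (reverse (C j)) (readingWord (suc j) m)) ⟩
      map (complement n) (reverse (readingWord (suc j) m) ++ reverse (reverse (C j)))
    ≡⟨ map-++ (complement n) (reverse (readingWord (suc j) m)) (reverse (reverse (C j))) ⟩
      rotatedWord (suc j) m ++ map (complement n) (reverse (reverse (C j)))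
    ≡⟨ cong (λ cs → rotatedWord (suc j) m ++ map (complement n) cs) (reverse-involutive (C j)) ⟩
      rotatedWord (suc j) m ++ map (complement n) (C j)
    ≡⟨ cong (rotatedWord (suc j) m ++_) (sym (reverse-involutive (map (complement n) (C j)))) ⟩
      rotatedWord (suc j) m ++ reverse (rotated j)
    ∎
    where open ≡-Reasoning

  insertWord-rotatedWord : ∀ j m → insertWord [] (rotatedWord j m) ≡ rotatedTableau j m
  insertWord-rotatedWord j zero = refl
  insertWord-rotatedWord j (suc m) =
    begin
      insertWord [] (rotatedWord j (suc m))
    ≡⟨ cong (insertWord []) (rotatedWord-suc j m) ⟩
      insertWord [] (rotatedWord (suc j) m ++ reverse (rotated j))
    ≡⟨ foldl-++ _ [] (rotatedWord (suc j) m) (reverse (rotated j)) ⟩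
      insertWord (insertWord [] (rotatedWord (suc j) m)) (reverse (rotated j))
    ≡⟨ cong (λ t → insertWord t (reverse (rotated j))) (insertWord-rotatedWord (suc j) m) ⟩
      insertWord (rotatedTableau (suc j) m) (reverse (rotated j))
    ≡⟨ insertWord-column (rotated↑ j) (rotatedTableau-fits (suc j) m (rotated↑ j) (rotated-nested j)) ⟩
      rotatedTableau j (suc m)
    ∎
    where open ≡-Reasoning

  colWordFrom-nested : ∀ {T w j} → width T ≡ w → (∀ {k} → k < w → column k T ≡ C k) → j ≤ w →
    colWordFrom T j ≡ readingWord j (w ∸ j)
  colWordFrom-nested {T} {w} {j} refl columns j≤w =
    cong concat (map-cong-local (Allₚ.applyUpTo⁺₁ (j +_) (w ∸ j) λ {i} i< →
      cong reverse (columns (subst (j + i <_) (m+[n∸m]≡n j≤w) (+-monoʳ-< j i<)))))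

  rightKeyColumn-nested : ∀ {T w j} → width T ≡ w → (∀ {k} → k < w → column k T ≡ C k) → j < w →
    rightKeyColumn n T j ≡ C j
  rightKeyColumn-nested {T} {suc w} {j} width≡ columns (s≤s j≤w) =
    begin
      rightKeyColumn n T j
    ≡⟨ cong (λ word → isort (map (complement n) (firstColumn (P (map (complement n) (reverse word))))))
            (trans (colWordFrom-nested {T} width≡ columns (≤-trans j≤w (n≤1+n w))) (cong (readingWord j) (+-∸-assoc 1 j≤w))) ⟩
      isort (map (complement n) (firstColumn (insertWord [] (rotatedWord j (suc (w ∸ j))))))
    ≡⟨ cong (λ t → isort (map (complement n) (firstColumn t))) (insertWord-rotatedWord j (suc (w ∸ j))) ⟩
      isort (map (complement n) (firstColumn (rotatedTableau j (suc (w ∸ j)))))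
    ≡⟨ cong (isort ∘′ map (complement n))
            (firstColumn-prependColumn (rotatedTableau-fits (suc j) (w ∸ j) (rotated↑ j) (rotated-nested j))) ⟩
      isort (map (complement n) (reverse (map (complement n) (C j))))
    ≡⟨ cong isort (reverse-map (complement n) (map (complement n) (C j))) ⟩
      isort (reverse (map (complement n) (map (complement n) (C j))))
    ≡⟨ cong (isort ∘′ reverse) (complement-involutive n (C≤n j)) ⟩
      isort (reverse (C j))
    ≡⟨ isort-reverse (C↑ j) ⟩
      C j
    ∎
    where open ≡-Reasoning

-- Semistandard tableaux

∧⁻ : ∀ {x y} → True (x ∧ y) → True x × True y
∧⁻ = Equivalence.to T-∧

∧⁺ : ∀ {x y} → True x → True y → True (x ∧ y)
∧⁺ p q = Equivalence.from T-∧ (p , q)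

InRange : ℕ → ℕ → Set
InRange n x = 1 ≤ x × x ≤ n

∈-range⁻ : ∀ n {x} → x ∈ range n → InRange n x
∈-range⁻ n x∈ with ∈-applyUpTo⁻ suc x∈
... | i , i<n , refl = s≤s z≤n , i<n

∈-range⁺ : ∀ n {x} → InRange n x → x ∈ range n
∈-range⁺ n {suc x} (_ , x<n) = ∈-applyUpTo⁺ suc x<n

∈-words⁻ : ∀ n l {w} → w ∈ words n l → length w ≡ l × All (InRange n) w
∈-words⁻ n zero (here refl) = refl , []
∈-words⁻ n (suc l) w∈ with find (∈-concatMap⁻ (λ a → map (a ∷_) (words n l)) {xs = range n} w∈)
... | a , a∈ , w∈′ with ∈-map⁻ (a ∷_) w∈′
...   | w , w∈″ , refl with ∈-words⁻ n l w∈″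
...     | len , w-range = cong suc len , ∈-range⁻ n a∈ ∷ w-range

∈-words⁺ : ∀ n {w} → All (InRange n) w → w ∈ words n (length w)
∈-words⁺ n [] = here refl
∈-words⁺ n {a ∷ w} (a-range ∷ w-range) =
  ∈-concatMap⁺ (λ b → map (b ∷_) (words n (length w))) (lose (∈-range⁺ n a-range) (∈-map⁺ (a ∷_) (∈-words⁺ n w-range)))

∈-fillings⁻ : ∀ n ls {T} → T ∈ fillings n ls → map length T ≡ ls × All (All (InRange n)) T
∈-fillings⁻ n [] (here refl) = refl , []
∈-fillings⁻ n (l ∷ ls) T∈ with find (∈-concatMap⁻ (λ r → map (r ∷_) (fillings n ls)) {xs = words n l} T∈)
... | r , r∈ , T∈′ with ∈-map⁻ (r ∷_) T∈′
...   | T , T∈″ , refl with ∈-words⁻ n l r∈ | ∈-fillings⁻ n ls T∈″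
...     | r-len , r-range | T-shape , T-range = cong₂ _∷_ r-len T-shape , r-range ∷ T-range

∈-fillings⁺ : ∀ n {T} → All (All (InRange n)) T → T ∈ fillings n (map length T)
∈-fillings⁺ n [] = here refl
∈-fillings⁺ n {r ∷ T} (r-range ∷ T-range) =
  ∈-concatMap⁺ (λ r′ → map (r′ ∷_) (fillings n (map length T))) (lose (∈-words⁺ n r-range) (∈-map⁺ (r ∷_) (∈-fillings⁺ n T-range)))

record IsTableau (n : ℕ) (lam : Vec ℕ n) (T : Filling) : Set where
  field
    shape : map length T ≡ toList lam
    entries : All (All (InRange n)) T
    semistandard : True (isSSYT T)

  columns↑ : True (columnsStrict T)
  columns↑ = proj₂ (∧⁻ {all weaklyIncreasing T} semistandard)

∈-𝒯⁻ : ∀ n lam {T} → T ∈ 𝒯 n lam → IsTableau n lam T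
∈-𝒯⁻ n lam T∈ with ∈-filter⁻ (λ T → T? (isSSYT T)) {xs = fillings n (toList lam)} T∈
... | T∈′ , ssyt with ∈-fillings⁻ n (toList lam) T∈′
...   | shape , entries = record { shape = shape ; entries = entries ; semistandard = ssyt }

∈-𝒯⁺ : ∀ n lam {T} → IsTableau n lam T → T ∈ 𝒯 n lam
∈-𝒯⁺ n lam {T} tab =
  ∈-filter⁺ (λ T → T? (isSSYT T)) (subst (λ ls → T ∈ fillings n ls) shape (∈-fillings⁺ n entries)) semistandard
  where
    open IsTableau tab

toList-All : ∀ {n} {P : ℕ → Set} (v : Vec ℕ n) → (∀ i → P (lookup v i)) → All P (toList v)
toList-All []ᵥ _ = []
toList-All (x ∷ᵥ v) p = p fzero ∷ toList-All v (λ i → p (fsuc i))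

partition⇒decreasing : ∀ {n} (lam : Vec ℕ n) → IsPartition lam → AllPairs _≥_ (toList lam)
partition⇒decreasing []ᵥ _ = []
partition⇒decreasing (x ∷ᵥ v) p =
  toList-All v (λ i → p fzero (fsuc i) z≤n) ∷ partition⇒decreasing v (λ i j i≤j → p (fsuc i) (fsuc j) (s≤s i≤j))

at-lookup : ∀ {n} (v : Vec ℕ n) i → at (toList v) (toℕ i) ≡ lookup v i
at-lookup (x ∷ᵥ v) fzero = refl
at-lookup (x ∷ᵥ v) (fsuc i) = at-lookup v i

countAtLeast : ℕ → List ℕ → ℕ
countAtLeast j ls = length (filterᵇ (j ≤ᵇ_) ls)

countAtLeast-∷-≤ : ∀ {j l} ls → j ≤ l → countAtLeast j (l ∷ ls) ≡ suc (countAtLeast j ls)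
countAtLeast-∷-≤ {j} ls j≤l = cong length (filter-accept (λ x → T? (j ≤ᵇ x)) {xs = ls} (≤⇒≤ᵇ j≤l))

countAtLeast-∷-> : ∀ {j l} ls → l < j → countAtLeast j (l ∷ ls) ≡ countAtLeast j ls
countAtLeast-∷-> {j} {l} ls l<j = cong length (filter-reject (λ x → T? (j ≤ᵇ x)) {xs = ls} (λ j≤l → <⇒≱ l<j (≤ᵇ⇒≤ j l j≤l)))

countAtLeast-antitone : ∀ {i j} ls → i ≤ j → countAtLeast j ls ≤ countAtLeast i ls
countAtLeast-antitone [] _ = z≤n
countAtLeast-antitone {i} {j} (l ∷ ls) i≤j with j ≤? l | i ≤? l
... | yes j≤l | _ rewrite countAtLeast-∷-≤ ls j≤l | countAtLeast-∷-≤ ls (≤-trans i≤j j≤l) =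
  s≤s (countAtLeast-antitone ls i≤j)
... | no j≰l | yes i≤l rewrite countAtLeast-∷-> ls (≰⇒> j≰l) | countAtLeast-∷-≤ ls i≤l =
  m≤n⇒m≤1+n (countAtLeast-antitone ls i≤j)
... | no j≰l | no i≰l rewrite countAtLeast-∷-> ls (≰⇒> j≰l) | countAtLeast-∷-> ls (≰⇒> i≰l) =
  countAtLeast-antitone ls i≤j

colLength-≤ : ∀ {n} (lam : Vec ℕ n) j → colLength lam j ≤ n
colLength-≤ lam j = subst (colLength lam j ≤_) (length-toList lam) (length-filter (λ x → T? (j ≤ᵇ x)) (toList lam))

nth-< : ∀ r {k} → k < length r → nth r k ≡ just (at r k)
nth-< (x ∷ r) {zero} _ = refl
nth-< (x ∷ r) {suc k} (s≤s k<) = nth-< r k<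

nth-≥ : ∀ r {k} → length r ≤ k → nth r k ≡ nothing
nth-≥ [] _ = refl
nth-≥ (x ∷ r) {suc k} (s≤s r≤k) = nth-≥ r r≤k

column-∷-< : ∀ {k} r T → k < length r → column k (r ∷ T) ≡ at r k ∷ column k T
column-∷-< {k} r T k< rewrite nth-< r {k} k< = refl

column-∷-≥ : ∀ {k} r T → length r ≤ k → column k (r ∷ T) ≡ column k T
column-∷-≥ {k} r T r≤k rewrite nth-≥ r {k} r≤k = refl

column-short : ∀ {k} T → All (_≤ k) (map length T) → column k T ≡ []
column-short [] _ = refl
column-short (r ∷ T) (r≤k ∷ T≤k) = trans (column-∷-≥ r T r≤k) (column-short T T≤k)

length-column : ∀ k T → length (column k T) ≡ countAtLeast (suc k) (map length T)
length-column k [] = refl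
length-column k (r ∷ T) with suc k ≤? length r
... | yes k< = begin
  length (column k (r ∷ T))               ≡⟨ cong length (column-∷-< r T k<) ⟩
  suc (length (column k T))               ≡⟨ cong suc (length-column k T) ⟩
  suc (countAtLeast (suc k) (map length T)) ≡⟨ countAtLeast-∷-≤ (map length T) k< ⟨
  countAtLeast (suc k) (map length (r ∷ T)) ∎
  where open ≡-Reasoning
... | no k≮ = begin
  length (column k (r ∷ T))               ≡⟨ cong length (column-∷-≥ r T (≮⇒≥ k≮)) ⟩
  length (column k T)                     ≡⟨ length-column k T ⟩
  countAtLeast (suc k) (map length T)     ≡⟨ countAtLeast-∷-> (map length T) (≰⇒> k≮) ⟨
  countAtLeast (suc k) (map length (r ∷ T)) ∎
  where open ≡-Reasoning

decreasing-bounded : ∀ {l ls k} → AllPairs _≥_ (l ∷ ls) → l ≤ k → All (_≤ k) (l ∷ ls)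
decreasing-bounded (l≥ls ∷ _) l≤k = l≤k ∷ All.map (λ x≤l → ≤-trans x≤l l≤k) l≥ls

strictlyBelow-at : ∀ r r' {k} → True (strictlyBelow r r') → k < length r → k < length r' → at r k < at r' k
strictlyBelow-at (a ∷ r) (b ∷ r') {zero} below _ _ = <ᵇ⇒< a b (proj₁ (∧⁻ below))
strictlyBelow-at (a ∷ r) (b ∷ r') {suc k} below (s≤s k<r) (s≤s k<r') =
  strictlyBelow-at r r' (proj₂ (∧⁻ {a <ᵇ b} below)) k<r k<r'

columnsStrict-tail : ∀ r T → True (columnsStrict (r ∷ T)) → True (columnsStrict T)
columnsStrict-tail r [] _ = _
columnsStrict-tail r (r' ∷ T) strict = proj₂ (∧⁻ {strictlyBelow r r'} strict)

column-linked-∷ : ∀ k r T → k < length r → True (columnsStrict (r ∷ T)) → AllPairs _≥_ (map length (r ∷ T)) →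
  Linked _<_ (at r k ∷ column k T)
column-linked-∷ k r [] _ _ _ = [-]
column-linked-∷ k r (r' ∷ T) k<r strict (_ ∷ rows↘) with k <? length r'
... | yes k<r' =
  subst (λ c → Linked _<_ (at r k ∷ c)) (sym (column-∷-< r' T k<r'))
    (strictlyBelow-at r r' (proj₁ (∧⁻ strict)) k<r k<r' ∷ column-linked-∷ k r' T k<r' (columnsStrict-tail r (r' ∷ T) strict) rows↘)
... | no k≮r' = subst (λ c → Linked _<_ (at r k ∷ c)) (sym (column-short (r' ∷ T) (decreasing-bounded rows↘ (≮⇒≥ k≮r')))) [-]

column-increasing : ∀ k T → True (columnsStrict T) → AllPairs _≥_ (map length T) → AllPairs _<_ (column k T)
column-increasing k [] _ _ = []
column-increasing k (r ∷ T) strict rows↘ with k <? length r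
... | yes k<r = subst (AllPairs _<_) (sym (column-∷-< r T k<r)) (Linked⇒AllPairs <-trans (column-linked-∷ k r T k<r strict rows↘))
... | no k≮r = subst (AllPairs _<_) (sym (column-short (r ∷ T) (decreasing-bounded rows↘ (≮⇒≥ k≮r)))) []

EntriesAbove : ℕ → List (List ℕ) → Set
EntriesAbove m [] = ⊤
EntriesAbove m (r ∷ rs) = All (m <_) r × EntriesAbove (suc m) rs

strictlyBelow-lower : ∀ {m} r r' → All (m <_) r → True (strictlyBelow r r') → length r' ≤ length r → All (suc m <_) r'
strictlyBelow-lower r [] _ _ _ = []
strictlyBelow-lower (a ∷ r) (b ∷ r') (m<a ∷ m<r) below (s≤s r'≤r) =
  <-≤-trans (s≤s m<a) (<ᵇ⇒< a b (proj₁ (∧⁻ below))) ∷ strictlyBelow-lower r r' m<r (proj₂ (∧⁻ {a <ᵇ b} below)) r'≤r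

columnsStrict-entriesAbove : ∀ {m} r T → All (m <_) r → True (columnsStrict (r ∷ T)) → AllPairs _≥_ (map length (r ∷ T)) →
  EntriesAbove m (r ∷ T)
columnsStrict-entriesAbove r [] m<r _ _ = m<r , _
columnsStrict-entriesAbove r (r' ∷ T) m<r strict ((r≥r' ∷ _) ∷ rows↘) =
  m<r , columnsStrict-entriesAbove r' T (strictlyBelow-lower r r' m<r (proj₁ (∧⁻ strict)) r≥r')
                                      (columnsStrict-tail r (r' ∷ T) strict) rows↘

foldr-⊔-≤ : ∀ {l} ls → All (_≤ l) ls → foldr _⊔_ 0 ls ≤ l
foldr-⊔-≤ [] [] = z≤n
foldr-⊔-≤ (x ∷ xs) (x≤l ∷ xs≤l) = ⊔-lub x≤l (foldr-⊔-≤ xs xs≤l)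

≤-foldr-⊔ : ∀ ls → All (_≤ foldr _⊔_ 0 ls) ls
≤-foldr-⊔ [] = []
≤-foldr-⊔ (l ∷ ls) = m≤m⊔n l _ ∷ All.map (λ x≤ → ≤-trans x≤ (m≤n⊔m l _)) (≤-foldr-⊔ ls)

positive-entriesAbove : ∀ {n} T → All (All (InRange n)) T → True (columnsStrict T) → AllPairs _≥_ (map length T) →
  EntriesAbove 0 T
positive-entriesAbove [] _ _ _ = _
positive-entriesAbove (r ∷ T) (r-range ∷ _) strict rows↘ =
  columnsStrict-entriesAbove r T (All.map proj₁ r-range) strict rows↘

module Semistandard {n} {lam : Vec ℕ n} {T} (partition : IsPartition lam) (tab : IsTableau n lam T) where
  open IsTableau tab

  rows↘ : AllPairs _≥_ (map length T)
  rows↘ = subst (AllPairs _≥_) (sym shape) (partition⇒decreasing lam partition)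

  column↑ : ∀ k → AllPairs _<_ (column k T)
  column↑ k = column-increasing k T columns↑ rows↘

  length-column≡colLength : ∀ k → length (column k T) ≡ colLength lam (suc k)
  length-column≡colLength k = trans (length-column k T) (cong (countAtLeast (suc k)) shape)

  entriesAbove : EntriesAbove 0 T
  entriesAbove = positive-entriesAbove T entries columns↑ rows↘

  rows≤numCols : All (_≤ numCols lam) (map length T)
  rows≤numCols = subst (All (_≤ numCols lam)) (sym shape) (≤-foldr-⊔ (toList lam))

  width≡numCols : width T ≡ numCols lam
  width≡numCols = trans (width-max T rows↘) (cong (foldr _⊔_ 0) shape)
    where
      width-max : ∀ T → AllPairs _≥_ (map length T) → width T ≡ foldr _⊔_ 0 (map length T)
      width-max [] _ = refl
      width-max (r ∷ T) (r≥T ∷ _) = sym (m≥n⇒m⊔n≡m (foldr-⊔-≤ (map length T) r≥T))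

countAtLeast-all-< : ∀ {j} ls → All (_< j) ls → countAtLeast j ls ≡ 0
countAtLeast-all-< {j} ls ls<j = cong length (filter-none (λ x → T? (j ≤ᵇ x)) (All.map (λ {l} l<j j≤l → <⇒≱ l<j (≤ᵇ⇒≤ j l j≤l)) ls<j))

-- Counting entries and dominance

count-++ : ∀ a xs ys → count a (xs ++ ys) ≡ count a xs + count a ys
count-++ a xs ys = trans (cong length (filter-++ (λ x → T? (a ≡ᵇ x)) xs ys)) (length-++ (filterᵇ (a ≡ᵇ_) xs))

count-∉ : ∀ {a xs} → a ∉ xs → count a xs ≡ 0
count-∉ {a} {xs} a∉ =
  cong length (filter-none (λ x → T? (a ≡ᵇ x)) (All.tabulate (λ {x} x∈ a≡ᵇx → a∉ (subst (_∈ xs) (sym (≡ᵇ⇒≡ a x a≡ᵇx)) x∈))))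

count-∷-≡ : ∀ a xs → count a (a ∷ xs) ≡ suc (count a xs)
count-∷-≡ a xs = cong length (filter-accept (λ y → T? (a ≡ᵇ y)) {xs = xs} (≡⇒≡ᵇ a a refl))

count-∷-≢ : ∀ a x xs → a ≢ x → count a (x ∷ xs) ≡ count a xs
count-∷-≢ a x xs a≢x = cong length (filter-reject (λ y → T? (a ≡ᵇ y)) {xs = xs} (λ a≡ᵇx → a≢x (≡ᵇ⇒≡ a x a≡ᵇx)))

count-unique-∈ : ∀ {a xs} → Unique xs → a ∈ xs → count a xs ≡ 1
count-unique-∈ {a} {x ∷ xs} (x≢xs ∷ _) (here refl) =
  trans (count-∷-≡ a xs) (cong suc (count-∉ (λ a∈ → All.lookup x≢xs a∈ refl)))
count-unique-∈ {a} {x ∷ xs} (x≢xs ∷ xs!) (there a∈) =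
  trans (count-∷-≢ a x xs (λ { refl → All.lookup x≢xs a∈ refl })) (count-unique-∈ xs! a∈)

count-unique-≤1 : ∀ a {xs} → Unique xs → count a xs ≤ 1
count-unique-≤1 a {xs} xs! with a ∈? xs
... | yes a∈ = ≤-reflexive (count-unique-∈ xs! a∈)
... | no a∉ = subst (_≤ 1) (sym (count-∉ a∉)) z≤n

-- The number of entries of xs lying in A, counted with the multiplicity of A.
countIn : List ℕ → List ℕ → ℕ
countIn A xs = sum (map (λ a → count a xs) A)

countIn-++ : ∀ A xs ys → countIn A (xs ++ ys) ≡ countIn A xs + countIn A ys
countIn-++ [] xs ys = refl
countIn-++ (a ∷ A) xs ys =
  trans (cong₂ _+_ (count-++ a xs ys) (countIn-++ A xs ys)) (interchange (count a xs) (count a ys) (countIn A xs) (countIn A ys))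

countIn-[] : ∀ A → countIn A [] ≡ 0
countIn-[] [] = refl
countIn-[] (a ∷ A) = countIn-[] A

countIn-[x]-∉ : ∀ {A x} → x ∉ A → countIn A [ x ] ≡ 0
countIn-[x]-∉ {[]} _ = refl
countIn-[x]-∉ {a ∷ A} {x} x∉ =
  cong₂ _+_ (count-∷-≢ a x [] (λ a≡x → x∉ (here (sym a≡x)))) (countIn-[x]-∉ (λ x∈ → x∉ (there x∈)))

countIn-[x]-∈ : ∀ {A x} → Unique A → x ∈ A → countIn A [ x ] ≡ 1
countIn-[x]-∈ {a ∷ A} (a≢A ∷ _) (here refl) =
  cong₂ _+_ (count-∷-≡ a []) (countIn-[x]-∉ (λ a∈ → All.lookup a≢A a∈ refl))
countIn-[x]-∈ {a ∷ A} {x} (a≢A ∷ A!) (there x∈) =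
  cong₂ _+_ (count-∷-≢ a x [] (λ { refl → All.lookup a≢A x∈ refl })) (countIn-[x]-∈ A! x∈)

countIn-∷ : ∀ A x xs → countIn A (x ∷ xs) ≡ countIn A [ x ] + countIn A xs
countIn-∷ A x xs = countIn-++ A [ x ] xs

countIn-≤-length : ∀ {A} → Unique A → ∀ xs → countIn A xs ≤ length xs
countIn-≤-length {A} A! [] = ≤-reflexive (countIn-[] A)
countIn-≤-length {A} A! (x ∷ xs) = subst (_≤ suc (length xs)) (sym (countIn-∷ A x xs)) (+-mono-≤ single (countIn-≤-length A! xs))
  where
    single : countIn A [ x ] ≤ 1
    single with x ∈? A
    ... | yes x∈ = ≤-reflexive (countIn-[x]-∈ A! x∈)
    ... | no x∉ = subst (_≤ 1) (sym (countIn-[x]-∉ x∉)) z≤n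

countIn-⊆ : ∀ {A xs} → Unique A → xs ⊆ A → countIn A xs ≡ length xs
countIn-⊆ {A} {[]} _ _ = countIn-[] A
countIn-⊆ {A} {x ∷ xs} A! xs⊆ =
  trans (countIn-∷ A x xs) (cong₂ _+_ (countIn-[x]-∈ A! (xs⊆ (here refl))) (countIn-⊆ A! (λ y∈ → xs⊆ (there y∈))))

countIn≡length⇒⊆ : ∀ {A} xs → Unique A → countIn A xs ≡ length xs → xs ⊆ A
countIn≡length⇒⊆ [] _ _ ()
countIn≡length⇒⊆ {A} (x ∷ xs) A! eq with x ∈? A
... | yes x∈ = λ { (here refl) → x∈ ; (there y∈) → countIn≡length⇒⊆ xs A! rest y∈ }
  where
    rest : countIn A xs ≡ length xs
    rest = suc-injective (trans (cong (_+ countIn A xs) (sym (countIn-[x]-∈ A! x∈))) (trans (sym (countIn-∷ A x xs)) eq))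
... | no x∉ = ⊥-elim (<-irrefl refl (begin-strict
    suc (length xs)      ≡⟨ eq ⟨
    countIn A (x ∷ xs)   ≡⟨ countIn-∷ A x xs ⟩
    countIn A [ x ] + countIn A xs ≡⟨ cong (_+ countIn A xs) (countIn-[x]-∉ x∉) ⟩
    countIn A xs         ≤⟨ countIn-≤-length A! xs ⟩
    length xs            <⟨ n<1+n (length xs) ⟩
    suc (length xs)      ∎))
  where open ≤-Reasoning

countIn-unique-≤ : ∀ A {xs} → Unique xs → countIn A xs ≤ length A
countIn-unique-≤ [] _ = z≤n
countIn-unique-≤ (a ∷ A) xs! = +-mono-≤ (count-unique-≤1 a xs!) (countIn-unique-≤ A xs!)

countIn-unique-⊇ : ∀ {A xs} → Unique xs → A ⊆ xs → countIn A xs ≡ length A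
countIn-unique-⊇ {[]} _ _ = refl
countIn-unique-⊇ {a ∷ A} xs! A⊆ = cong₂ _+_ (count-unique-∈ xs! (A⊆ (here refl))) (countIn-unique-⊇ xs! (λ y∈ → A⊆ (there y∈)))

countIn-disjoint : ∀ {A} xs → All (_∉ A) xs → countIn A xs ≡ 0
countIn-disjoint {A} [] _ = countIn-[] A
countIn-disjoint {A} (x ∷ xs) (x∉ ∷ xs∉) = trans (countIn-∷ A x xs) (cong₂ _+_ (countIn-[x]-∉ x∉) (countIn-disjoint xs xs∉))

lookup-content : ∀ n T (i : Fin n) → lookup (content n T) i ≡ count (suc (toℕ i)) (concat T)
lookup-content n T i = lookup∘tabulate (λ j → count (suc (toℕ j)) (concat T)) i

content-≡⇒count-≡ : ∀ {n} T T′ → content n T ≡ content n T′ →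
  ∀ {a} → InRange n a → count a (concat T) ≡ count a (concat T′)
content-≡⇒count-≡ {n} T T′ eq {suc x} (_ , x<n) =
  subst (λ y → count (suc y) (concat T) ≡ count (suc y) (concat T′)) (toℕ-fromℕ< x<n)
    (trans (sym (lookup-content n T i)) (trans (cong (λ v → lookup v i) eq) (lookup-content n T′ i)))
  where i = fromℕ< x<n

content≡⇒count≡at : ∀ {n} T (lam : Vec ℕ n) → content n T ≡ lam → ∀ {x} → x < n → count (suc x) (concat T) ≡ at (toList lam) x
content≡⇒count≡at {n} T lam eq {x} x<n =
  subst (λ y → count (suc y) (concat T) ≡ at (toList lam) y) (toℕ-fromℕ< x<n)
    (trans (sym (lookup-content n T i)) (trans (cong (λ v → lookup v i) eq) (sym (at-lookup lam i))))
  where i = fromℕ< x<n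

countIn-content : ∀ {n} A T T′ → All (InRange n) A → content n T ≡ content n T′ → countIn A (concat T) ≡ countIn A (concat T′)
countIn-content A T T′ A-range eq = cong sum (map-cong-local (All.map (content-≡⇒count-≡ T T′ eq) A-range))

range-unique : ∀ k → Unique (range k)
range-unique k = increasing⇒unique (AllPairsₚ.applyUpTo⁺₁ suc k (λ i<j _ → s≤s i<j))

countIn-applyUpTo : ∀ k (f : ℕ → ℕ) L xs → k ≤ length L → (∀ {i} → i < k → count (f i) xs ≡ at L i) →
  countIn (applyUpTo f k) xs ≡ sum (take k L)
countIn-applyUpTo zero f L xs _ _ = refl
countIn-applyUpTo (suc k) f (l ∷ L) xs (s≤s k≤) eq =
  cong₂ _+_ (eq (s≤s z≤n)) (countIn-applyUpTo k (λ i → f (suc i)) L xs k≤ (λ i<k → eq (s≤s i<k)))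

entriesAbove-concat : ∀ {m} rs → EntriesAbove m rs → All (m <_) (concat rs)
entriesAbove-concat [] _ = []
entriesAbove-concat (r ∷ rs) (m<r , rest) = Allₚ.++⁺ m<r (All.map (λ m<x → <-trans (n<1+n _) m<x) (entriesAbove-concat rs rest))

-- The entries ≤ k lie in the first k ∸ m rows.
countIn-range-entriesAbove : ∀ k {m} rs → EntriesAbove m rs → countIn (range k) (concat rs) ≤ sum (take (k ∸ m) (map length rs))
countIn-range-entriesAbove k {m} [] _ = subst (_≤ sum (take (k ∸ m) [])) (sym (countIn-[] (range k))) z≤n
countIn-range-entriesAbove k {m} (r ∷ rs) (m<r , rest) with k ≤? m
... | yes k≤m = subst (_≤ sum (take (k ∸ m) (map length (r ∷ rs)))) (sym (countIn-disjoint (r ++ concat rs)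
                  (All.map (λ m<x x∈ → <⇒≱ (≤-<-trans k≤m m<x) (proj₂ (∈-range⁻ k x∈))) (entriesAbove-concat (r ∷ rs) (m<r , rest)))))
                  z≤n
... | no k≰m = subst (λ d → countIn (range k) (r ++ concat rs) ≤ sum (take d (map length (r ∷ rs)))) (sym (+-∸-assoc 1 (≰⇒> k≰m)))
    (begin
      countIn (range k) (r ++ concat rs)                   ≡⟨ countIn-++ (range k) r (concat rs) ⟩
      countIn (range k) r + countIn (range k) (concat rs)  ≤⟨ +-mono-≤ (countIn-≤-length (range-unique k) r)
                                                                        (countIn-range-entriesAbove k rs rest) ⟩
      length r + sum (take (k ∸ suc m) (map length rs))    ∎)
  where open ≤-Reasoning

_⊴_ : ∀ {n} → Vec ℕ n → Vec ℕ n → Set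
_⊴_ {n} lam mu = ∀ {k} → k ≤ n → sum (take k (toList lam)) ≤ sum (take k (toList mu))

content-⊴-shape : ∀ {n} {lam mu : Vec ℕ n} {T} → IsPartition mu → IsTableau n mu T → content n T ≡ lam → lam ⊴ mu
content-⊴-shape {n} {lam} {mu} {T} mu-partition tab eq {k} k≤n = begin
  sum (take k (toList lam))     ≡⟨ countIn-applyUpTo k suc (toList lam) (concat T) k≤length count≡ ⟨
  countIn (range k) (concat T)  ≤⟨ countIn-range-entriesAbove k T entriesAbove ⟩
  sum (take k (map length T))   ≡⟨ cong (sum ∘′ take k) shape ⟩
  sum (take k (toList mu))      ∎
  where
    open ≤-Reasoning
    open IsTableau tab using (shape)
    open Semistandard mu-partition tab using (entriesAbove)
    k≤length : k ≤ length (toList lam)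
    k≤length = subst (k ≤_) (sym (length-toList lam)) k≤n
    count≡ : ∀ {i} → i < k → count (suc i) (concat T) ≡ at (toList lam) i
    count≡ i<k = content≡⇒count≡at T lam eq (<-≤-trans i<k k≤n)

prefixSums-injective : ∀ xs ys → length xs ≡ length ys →
  (∀ {k} → k ≤ length xs → sum (take k xs) ≡ sum (take k ys)) → xs ≡ ys
prefixSums-injective [] [] _ _ = refl
prefixSums-injective (x ∷ xs) (y ∷ ys) len sums = cong₂ _∷_ x≡y
  (prefixSums-injective xs ys (suc-injective len)
    (λ k≤ → +-cancelˡ-≡ x _ _ (trans (sums (s≤s k≤)) (cong (_+ _) (sym x≡y)))))
  where
    x≡y : x ≡ y
    x≡y = trans (sym (+-identityʳ x)) (trans (sums (s≤s z≤n)) (+-identityʳ y))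

⊴-antisym : ∀ {n} {lam mu : Vec ℕ n} → lam ⊴ mu → mu ⊴ lam → lam ≡ mu
⊴-antisym {n} {lam} {mu} lam⊴mu mu⊴lam =
  trans (sym (cast-is-id refl lam)) (toList-injective refl lam mu
    (prefixSums-injective (toList lam) (toList mu) (trans (length-toList lam) (sym (length-toList mu)))
      (λ k≤ → let k≤n = subst (_ ≤_) (length-toList lam) k≤ in ≤-antisym (lam⊴mu k≤n) (mu⊴lam k≤n))))

sumBelow : ℕ → (ℕ → ℕ) → ℕ
sumBelow w f = sum (applyUpTo f w)

sumBelow-cong : ∀ w {f g} → (∀ {k} → k < w → f k ≡ g k) → sumBelow w f ≡ sumBelow w g
sumBelow-cong w f≗g = cong sum (applyUpTo-cong w f≗g)

sumBelow-zero : ∀ w {f} → (∀ {k} → k < w → f k ≡ 0) → sumBelow w f ≡ 0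
sumBelow-zero zero _ = refl
sumBelow-zero (suc w) f≗0 = cong₂ _+_ (f≗0 (s≤s z≤n)) (sumBelow-zero w (λ k<w → f≗0 (s≤s k<w)))

sumBelow-+ : ∀ w f g → sumBelow w (λ k → f k + g k) ≡ sumBelow w f + sumBelow w g
sumBelow-+ zero f g = refl
sumBelow-+ (suc w) f g =
  trans (cong (f 0 + g 0 +_) (sumBelow-+ w (λ k → f (suc k)) (λ k → g (suc k))))
        (interchange (f 0) (g 0) (sumBelow w (λ k → f (suc k))) (sumBelow w (λ k → g (suc k))))

sumBelow-mono : ∀ w {f g} → (∀ {k} → k < w → f k ≤ g k) → sumBelow w f ≤ sumBelow w g
sumBelow-mono zero _ = z≤n
sumBelow-mono (suc w) f≤g = +-mono-≤ (f≤g (s≤s z≤n)) (sumBelow-mono w (λ k<w → f≤g (s≤s k<w)))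

+-≤-≡⇒≡ : ∀ {a b c d} → a ≤ b → c ≤ d → a + c ≡ b + d → a ≡ b × c ≡ d
+-≤-≡⇒≡ {a} {b} {c} {d} a≤b c≤d eq = a≡b , +-cancelˡ-≡ b c d (trans (cong (_+ c) (sym a≡b)) eq)
  where
    a≡b : a ≡ b
    a≡b = ≤-antisym a≤b (+-cancelʳ-≤ d b a (subst (_≤ a + d) eq (+-monoʳ-≤ a c≤d)))

sumBelow-≤-≡⇒≡ : ∀ w {f g} → (∀ {k} → k < w → f k ≤ g k) → sumBelow w f ≡ sumBelow w g → ∀ {k} → k < w → f k ≡ g k
sumBelow-≤-≡⇒≡ (suc w) {f} {g} f≤g eq {k} k<w with +-≤-≡⇒≡ (f≤g (s≤s z≤n)) (sumBelow-mono w (λ k<w → f≤g (s≤s k<w))) eq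
sumBelow-≤-≡⇒≡ (suc w) f≤g eq {zero} _ | f0≡g0 , _ = f0≡g0
sumBelow-≤-≡⇒≡ (suc w) f≤g eq {suc k} (s≤s k<w) | _ , rest = sumBelow-≤-≡⇒≡ w (λ k<w → f≤g (s≤s k<w)) rest k<w

countIn-row : ∀ A r {w} → length r ≤ w → countIn A r ≡ sumBelow w (λ k → countIn A (maybeList (nth r k)))
countIn-row A [] {w} _ = trans (countIn-[] A) (sym (sumBelow-zero w (λ _ → countIn-[] A)))
countIn-row A (x ∷ r) {suc w} (s≤s r≤w) = trans (countIn-∷ A x r) (cong (countIn A [ x ] +_) (countIn-row A r r≤w))

countIn-columns : ∀ A T {w} → All (_≤ w) (map length T) → countIn A (concat T) ≡ sumBelow w (λ k → countIn A (column k T))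
countIn-columns A [] {w} _ = trans (countIn-[] A) (sym (sumBelow-zero w (λ _ → countIn-[] A)))
countIn-columns A (r ∷ T) {w} (r≤w ∷ T≤w) =
  begin
    countIn A (r ++ concat T)
  ≡⟨ countIn-++ A r (concat T) ⟩
    countIn A r + countIn A (concat T)
  ≡⟨ cong₂ _+_ (countIn-row A r r≤w) (countIn-columns A T T≤w) ⟩
    sumBelow w (λ k → countIn A (maybeList (nth r k))) + sumBelow w (λ k → countIn A (column k T))
  ≡⟨ sumBelow-+ w _ _ ⟨
    sumBelow w (λ k → countIn A (maybeList (nth r k)) + countIn A (column k T))
  ≡⟨ sumBelow-cong w (λ {k} _ → countIn-++ A (maybeList (nth r k)) (column k T)) ⟨
    sumBelow w (λ k → countIn A (column k (r ∷ T)))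
  ∎
  where open ≡-Reasoning

-- Keys

-- C k is column k + 1 of a key of shape λ, read top to bottom.
record IsKey (n : ℕ) (lam : Vec ℕ n) (C : ℕ → List ℕ) : Set where
  field
    increasing : ∀ k → AllPairs _<_ (C k)
    entries : ∀ k → All (InRange n) (C k)
    nested : ∀ k → C (suc k) ⊆ C k
    length≡ : ∀ k → length (C k) ≡ colLength lam (suc k)

  nested-≤ : ∀ {j k} → j ≤ k → C k ⊆ C j
  nested-≤ {k = zero} z≤n = ⊆-refl
  nested-≤ {k = suc k} j≤1+k with m≤n⇒m<n∨m≡n j≤1+k
  ... | inj₁ j<1+k = ⊆-trans (nested k) (nested-≤ (≤-pred j<1+k))
  ... | inj₂ refl = ⊆-refl

  entries≤n : ∀ k → All (_≤ n) (C k)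
  entries≤n k = All.map proj₂ (entries k)

rowsOf : (ℕ → List ℕ) → ℕ → List ℕ → Filling
rowsOf C t [] = []
rowsOf C t (l ∷ ls) = applyUpTo (λ k → at (C k) t) l ∷ rowsOf C (suc t) ls

tableauOf : ∀ {n} → (ℕ → List ℕ) → Vec ℕ n → Filling
tableauOf C lam = rowsOf C 0 (toList lam)

-- ls are the row lengths of L from row t on: a column through their first row
-- has t cells above it.
RowsFrom : List ℕ → ℕ → List ℕ → Set
RowsFrom L t [] = ⊤
RowsFrom L t (l ∷ ls) = ∀ {k} → k < l → t + countAtLeast (suc k) (l ∷ ls) ≡ countAtLeast (suc k) L

rowsFrom-suc : ∀ {L t l ls} → RowsFrom L t (l ∷ ls) → AllPairs _≥_ (l ∷ ls) → RowsFrom L (suc t) ls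
rowsFrom-suc {ls = []} _ _ = _
rowsFrom-suc {L} {t} {l} {l₂ ∷ ls} below ((l≥l₂ ∷ _) ∷ _) {k} k<l₂ =
  trans (sym (+-suc t (countAtLeast (suc k) (l₂ ∷ ls))))
        (trans (cong (t +_) (sym (countAtLeast-∷-≤ (l₂ ∷ ls) (≤-trans k<l₂ l≥l₂)))) (below (≤-trans k<l₂ l≥l₂)))

rowsFrom-< : ∀ {L t l ls k} → RowsFrom L t (l ∷ ls) → k < l → t < countAtLeast (suc k) L
rowsFrom-< {L} {t} {l} {ls} {k} below k<l =
  subst (t <_) (trans (cong (t +_) (sym (countAtLeast-∷-≤ ls k<l))) (below k<l))
    (subst (t <_) (sym (+-suc t _)) (s≤s (m≤m+n t _)))

weaklyIncreasing-applyUpTo : ∀ (g : ℕ → ℕ) l → (∀ {k} → suc k < l → g k ≤ g (suc k)) → True (weaklyIncreasing (applyUpTo g l))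
weaklyIncreasing-applyUpTo g zero _ = _
weaklyIncreasing-applyUpTo g (suc zero) _ = _
weaklyIncreasing-applyUpTo g (suc (suc l)) g↗ =
  ∧⁺ (≤⇒≤ᵇ (g↗ (s≤s (s≤s z≤n)))) (weaklyIncreasing-applyUpTo (λ k → g (suc k)) (suc l) (λ k< → g↗ (s≤s k<)))

strictlyBelow-applyUpTo : ∀ (g h : ℕ → ℕ) a b → (∀ {k} → k < a → k < b → g k < h k) →
  True (strictlyBelow (applyUpTo g a) (applyUpTo h b))
strictlyBelow-applyUpTo g h zero b _ = _
strictlyBelow-applyUpTo g h (suc a) zero _ = _
strictlyBelow-applyUpTo g h (suc a) (suc b) g<h =
  ∧⁺ (<⇒<ᵇ (g<h (s≤s z≤n) (s≤s z≤n)))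
     (strictlyBelow-applyUpTo (λ k → g (suc k)) (λ k → h (suc k)) a b (λ k<a k<b → g<h (s≤s k<a) (s≤s k<b)))

rowsFrom-0 : ∀ L → RowsFrom L 0 L
rowsFrom-0 [] = _
rowsFrom-0 (l ∷ ls) _ = refl

module KeyTableau {n} {lam : Vec ℕ n} {C} (key : IsKey n lam C) where
  open IsKey key

  private
    L = toList lam

  entry-exists : ∀ {t l ls k} → RowsFrom L t (l ∷ ls) → k < l → t < length (C k)
  entry-exists {t} {k = k} below k<l = subst (t <_) (sym (length≡ k)) (rowsFrom-< {L} below k<l)

  shape-rowsOf : ∀ t ls → map length (rowsOf C t ls) ≡ ls
  shape-rowsOf t [] = refl
  shape-rowsOf t (l ∷ ls) = cong₂ _∷_ (length-applyUpTo _ l) (shape-rowsOf (suc t) ls)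

  entries-rowsOf : ∀ t ls → RowsFrom L t ls → AllPairs _≥_ ls → All (All (InRange n)) (rowsOf C t ls)
  entries-rowsOf t [] _ _ = []
  entries-rowsOf t (l ∷ ls) below ls↘ =
    Allₚ.applyUpTo⁺₁ _ l (λ {k} k<l → All.lookup (entries k) (at-∈ (C k) (entry-exists below k<l)))
    ∷ entries-rowsOf (suc t) ls (rowsFrom-suc {L} below ls↘) (AllPairs.tail ls↘)

  rows↗-rowsOf : ∀ t ls → RowsFrom L t ls → AllPairs _≥_ ls → True (all weaklyIncreasing (rowsOf C t ls))
  rows↗-rowsOf t [] _ _ = _
  rows↗-rowsOf t (l ∷ ls) below ls↘ =
    ∧⁺ (weaklyIncreasing-applyUpTo _ l (λ {k} k+1<l →
          ⊆⇒at-≤ t (increasing (suc k)) (increasing k) (nested k) (entry-exists below k+1<l)))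
       (rows↗-rowsOf (suc t) ls (rowsFrom-suc {L} below ls↘) (AllPairs.tail ls↘))

  columnsStrict-rowsOf : ∀ t ls → RowsFrom L t ls → AllPairs _≥_ ls → True (columnsStrict (rowsOf C t ls))
  columnsStrict-rowsOf t [] _ _ = _
  columnsStrict-rowsOf t (l ∷ []) _ _ = _
  columnsStrict-rowsOf t (l ∷ l₂ ∷ ls) below ls↘ =
    ∧⁺ (strictlyBelow-applyUpTo _ _ l l₂ (λ {k} _ k<l₂ →
          increasing-at-suc t (increasing k) (entry-exists (rowsFrom-suc {L} below ls↘) k<l₂)))
       (columnsStrict-rowsOf (suc t) (l₂ ∷ ls) (rowsFrom-suc {L} below ls↘) (AllPairs.tail ls↘))

  column-rowsOf : ∀ k t ls → AllPairs _≥_ ls →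
    column k (rowsOf C t ls) ≡ applyUpTo (λ i → at (C k) (t + i)) (countAtLeast (suc k) ls)
  column-rowsOf k t [] _ = refl
  column-rowsOf k t (l ∷ ls) ls↘ with suc k ≤? l
  ... | yes k<l =
    begin
      column k (row ∷ rowsOf C (suc t) ls)
    ≡⟨ column-∷-< row (rowsOf C (suc t) ls) (subst (k <_) (sym (length-applyUpTo _ l)) k<l) ⟩
      at row k ∷ column k (rowsOf C (suc t) ls)
    ≡⟨ cong₂ _∷_ (trans (at-applyUpTo _ k<l) (cong (at (C k)) (sym (+-identityʳ t)))) (column-rowsOf k (suc t) ls (AllPairs.tail ls↘)) ⟩
      at (C k) (t + 0) ∷ applyUpTo (λ i → at (C k) (suc t + i)) (countAtLeast (suc k) ls)
    ≡⟨ cong (at (C k) (t + 0) ∷_) (applyUpTo-cong _ (λ _ → cong (at (C k)) (sym (+-suc t _)))) ⟩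
      applyUpTo (λ i → at (C k) (t + i)) (suc (countAtLeast (suc k) ls))
    ≡⟨ cong (applyUpTo (λ i → at (C k) (t + i))) (countAtLeast-∷-≤ ls k<l) ⟨
      applyUpTo (λ i → at (C k) (t + i)) (countAtLeast (suc k) (l ∷ ls))
    ∎
    where
      open ≡-Reasoning
      row = applyUpTo (λ k → at (C k) t) l
  ... | no k≮l = trans (column-short (rowsOf C t (l ∷ ls)) (subst (All (_≤ k)) (sym (shape-rowsOf t (l ∷ ls))) short))
                       (cong (applyUpTo _) (sym (countAtLeast-all-< (l ∷ ls) (All.map s≤s short))))
    where
      short : All (_≤ k) (l ∷ ls)
      short = decreasing-bounded ls↘ (≮⇒≥ k≮l)

  module _ (partition : IsPartition lam) where

    private
      L↘ = partition⇒decreasing lam partition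

    column-tableauOf : ∀ k → column k (tableauOf C lam) ≡ C k
    column-tableauOf k =
      trans (column-rowsOf k 0 L L↘) (trans (cong (applyUpTo (at (C k))) (sym (length≡ k))) (applyUpTo-at (C k)))

    tableauOf-isTableau : IsTableau n lam (tableauOf C lam)
    tableauOf-isTableau = record
      { shape = shape-rowsOf 0 L
      ; entries = entries-rowsOf 0 L (rowsFrom-0 L) L↘
      ; semistandard = ∧⁺ (rows↗-rowsOf 0 L (rowsFrom-0 L) L↘) (columnsStrict-rowsOf 0 L (rowsFrom-0 L) L↘)
      }

module _ {n} {lam : Vec ℕ n} {C} (key : IsKey n lam C) (partition : IsPartition lam) {T} (tab : IsTableau n lam T) where
  open IsKey key
  open KeyTableau key
  open Semistandard partition tab using (column↑; length-column≡colLength; rows≤numCols; width≡numCols)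

  private
    Y = tableauOf C lam
    length-column≡key : ∀ k → length (column k T) ≡ length (C k)
    length-column≡key k = trans (length-column≡colLength k) (sym (length≡ k))

  countIn-column-≤ : ∀ k₀ k → countIn (C k₀) (column k T) ≤ countIn (C k₀) (C k)
  countIn-column-≤ k₀ k with k₀ ≤? k
  ... | yes k₀≤k = begin
    countIn (C k₀) (column k T)  ≤⟨ countIn-≤-length (increasing⇒unique (increasing k₀)) (column k T) ⟩
    length (column k T)          ≡⟨ length-column≡key k ⟩
    length (C k)                 ≡⟨ countIn-⊆ (increasing⇒unique (increasing k₀)) (nested-≤ k₀≤k) ⟨
    countIn (C k₀) (C k)         ∎
    where open ≤-Reasoning
  ... | no k₀≰k = begin
    countIn (C k₀) (column k T)  ≤⟨ countIn-unique-≤ (C k₀) (increasing⇒unique (column↑ k)) ⟩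
    length (C k₀)                ≡⟨ countIn-unique-⊇ (increasing⇒unique (increasing k)) (nested-≤ (<⇒≤ (≰⇒> k₀≰k))) ⟨
    countIn (C k₀) (C k)         ∎
    where open ≤-Reasoning

  countIn-columns-key : ∀ A → All (InRange n) A → content n T ≡ content n Y →
    sumBelow (numCols lam) (λ k → countIn A (column k T)) ≡ sumBelow (numCols lam) (λ k → countIn A (C k))
  countIn-columns-key A A-range same-content = begin
    sumBelow (numCols lam) (λ k → countIn A (column k T))  ≡⟨ countIn-columns A T rows≤numCols ⟨
    countIn A (concat T)                                  ≡⟨ countIn-content A T Y A-range same-content ⟩
    countIn A (concat Y)                                  ≡⟨ countIn-columns A Y (Semistandard.rows≤numCols partition (tableauOf-isTableau partition)) ⟩
    sumBelow (numCols lam) (λ k → countIn A (column k Y)) ≡⟨ sumBelow-cong (numCols lam) (λ {k} _ → cong (countIn A) (column-tableauOf partition k)) ⟩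
    sumBelow (numCols lam) (λ k → countIn A (C k))        ∎
    where open ≡-Reasoning

  -- Counting, column by column, the entries lying in C k₀ forces column k₀ into C k₀.
  key-rigid : content n T ≡ content n Y → ∀ {k₀} → k₀ < numCols lam → column k₀ T ≡ C k₀
  key-rigid same-content {k₀} k₀<w =
    increasing-⊆-length⇒≡ (column↑ k₀) (increasing k₀) column⊆ (≤-reflexive (sym (length-column≡key k₀)))
    where
      A! = increasing⇒unique (increasing k₀)
      full : countIn (C k₀) (column k₀ T) ≡ length (column k₀ T)
      full = begin
        countIn (C k₀) (column k₀ T) ≡⟨ sumBelow-≤-≡⇒≡ (numCols lam) (λ {k} _ → countIn-column-≤ k₀ k)
                                          (countIn-columns-key (C k₀) (entries k₀) same-content) k₀<w ⟩
        countIn (C k₀) (C k₀)        ≡⟨ countIn-⊆ A! ⊆-refl ⟩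
        length (C k₀)                ≡⟨ length-column≡key k₀ ⟨
        length (column k₀ T)         ∎
        where open ≡-Reasoning
      column⊆ : column k₀ T ⊆ C k₀
      column⊆ = countIn≡length⇒⊆ (column k₀ T) A! full

  rightKeyColumn-key : (∀ {k} → k < numCols lam → column k T ≡ C k) → ∀ {j} → j < numCols lam → rightKeyColumn n T j ≡ C j
  rightKeyColumn-key columns = NestedColumns.rightKeyColumn-nested n C increasing entries≤n nested {T} width≡numCols columns

-- The superstandard tableau

superstandardColumn : ∀ {n} → Vec ℕ n → ℕ → List ℕ
superstandardColumn lam k = range (colLength lam (suc k))

superstandard-isKey : ∀ {n} (lam : Vec ℕ n) → IsKey n lam (superstandardColumn lam)
superstandard-isKey {n} lam = record
  { increasing = λ k → AllPairsₚ.applyUpTo⁺₁ suc _ (λ i<j _ → s≤s i<j)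
  ; entries = λ k → All.tabulate (λ x∈ → let (1≤x , x≤c) = ∈-range⁻ _ x∈ in 1≤x , ≤-trans x≤c (colLength-≤ lam (suc k)))
  ; nested = λ k x∈ → let (1≤x , x≤c) = ∈-range⁻ _ x∈ in
      ∈-range⁺ _ (1≤x , ≤-trans x≤c (countAtLeast-antitone (toList lam) (n≤1+n (suc k))))
  ; length≡ = λ k → length-applyUpTo suc _
  }

superstandardRows : ℕ → List ℕ → Filling
superstandardRows t [] = []
superstandardRows t (l ∷ ls) = replicate l (suc t) ∷ superstandardRows (suc t) ls

applyUpTo-const : ∀ (x : ℕ) l → applyUpTo (λ _ → x) l ≡ replicate l x
applyUpTo-const x zero = refl
applyUpTo-const x (suc l) = cong (x ∷_) (applyUpTo-const x l)

rowsOf-superstandard : ∀ {n} (lam : Vec ℕ n) t ls → RowsFrom (toList lam) t ls → AllPairs _≥_ ls →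
  rowsOf (superstandardColumn lam) t ls ≡ superstandardRows t ls
rowsOf-superstandard lam t [] _ _ = refl
rowsOf-superstandard lam t (l ∷ ls) below ls↘ =
  cong₂ _∷_ (trans (applyUpTo-cong l (λ k<l → at-applyUpTo suc (rowsFrom-< {toList lam} below k<l))) (applyUpTo-const (suc t) l))
            (rowsOf-superstandard lam (suc t) ls (rowsFrom-suc {toList lam} below ls↘) (AllPairs.tail ls↘))

superstandard : ∀ {n} → Vec ℕ n → Filling
superstandard lam = tableauOf (superstandardColumn lam) lam

superstandard-rows : ∀ {n} (lam : Vec ℕ n) → IsPartition lam → superstandard lam ≡ superstandardRows 0 (toList lam)
superstandard-rows lam partition = rowsOf-superstandard lam 0 (toList lam) (rowsFrom-0 (toList lam)) (partition⇒decreasing lam partition)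

superstandardRows-entriesAbove : ∀ t ls → EntriesAbove t (superstandardRows t ls)
superstandardRows-entriesAbove t [] = _
superstandardRows-entriesAbove t (l ∷ ls) = Allₚ.replicate⁺ l (n<1+n t) , superstandardRows-entriesAbove (suc t) ls

count-replicate-≡ : ∀ a l → count a (replicate l a) ≡ l
count-replicate-≡ a zero = refl
count-replicate-≡ a (suc l) = trans (count-∷-≡ a (replicate l a)) (cong suc (count-replicate-≡ a l))

count-replicate-≢ : ∀ {a b} l → a ≢ b → count a (replicate l b) ≡ 0
count-replicate-≢ zero _ = refl
count-replicate-≢ {a} {b} (suc l) a≢b = trans (count-∷-≢ a b (replicate l b) a≢b) (count-replicate-≢ l a≢b)

count-superstandardRows : ∀ t ls i → count (suc (t + i)) (concat (superstandardRows t ls)) ≡ at ls i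
count-superstandardRows t [] i = refl
count-superstandardRows t (l ∷ ls) i =
  trans (count-++ (suc (t + i)) (replicate l (suc t)) (concat (superstandardRows (suc t) ls))) (split i)
  where
    split : ∀ i → count (suc (t + i)) (replicate l (suc t)) + count (suc (t + i)) (concat (superstandardRows (suc t) ls)) ≡ at (l ∷ ls) i
    split zero rewrite +-identityʳ t = trans
      (cong₂ _+_ (count-replicate-≡ (suc t) l)
        (count-∉ (λ t+1∈ → <-irrefl refl (All.lookup (entriesAbove-concat _ (superstandardRows-entriesAbove (suc t) ls)) t+1∈))))
      (+-identityʳ l)
    split (suc i) rewrite +-suc t i =
      cong₂ _+_ (count-replicate-≢ l (λ eq → <-irrefl (sym (suc-injective eq)) (s≤s (m≤m+n t i)))) (count-superstandardRows (suc t) ls i)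

content-superstandard : ∀ {n} (lam : Vec ℕ n) → IsPartition lam → content n (superstandard lam) ≡ lam
content-superstandard {n} lam partition =
  begin
    content n (superstandard lam)
  ≡⟨ cong (content n) (superstandard-rows lam partition) ⟩
    tabulate (λ i → count (suc (toℕ i)) (concat (superstandardRows 0 (toList lam))))
  ≡⟨ tabulate-cong (λ i → trans (count-superstandardRows 0 (toList lam) (toℕ i)) (at-lookup lam i)) ⟩
    tabulate (lookup lam)
  ≡⟨ tabulate∘lookup lam ⟩
    lam
  ∎
  where open ≡-Reasoning

rowBounded-superstandardRows : ∀ t βs ls → (∀ {i} → i < length βs → suc (t + i) ≤ at βs i) →
  True (rowBounded βs (superstandardRows t ls))
rowBounded-superstandardRows t [] ls _ = _
rowBounded-superstandardRows t (b ∷ βs) [] _ = _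
rowBounded-superstandardRows t (b ∷ βs) (l ∷ ls) bound =
  ∧⁺ (Allₚ.all⁻ (_≤ᵇ b) (Allₚ.replicate⁺ l (≤⇒≤ᵇ (subst (λ x → suc x ≤ b) (+-identityʳ t) (bound (s≤s z≤n))))))
     (rowBounded-superstandardRows (suc t) βs ls (λ {i} i< → subst (λ x → suc x ≤ at βs i) (+-suc t i) (bound (s≤s i<))))

superstandard-rowBounded : ∀ {n} (lam β : Vec ℕ n) → IsPartition lam → InU n β → True (rowBounded (toList β) (superstandard lam))
superstandard-rowBounded {n} lam β partition β∈U =
  subst (λ T → True (rowBounded (toList β) T)) (sym (superstandard-rows lam partition))
    (rowBounded-superstandardRows 0 (toList β) (toList lam) bound)
  where
    bound : ∀ {i} → i < length (toList β) → suc i ≤ at (toList β) i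
    bound {i} i< = subst₂ (λ j b → suc j ≤ b) (toℕ-fromℕ< i<n)
                     (trans (sym (at-lookup β (fromℕ< i<n))) (cong (at (toList β)) (toℕ-fromℕ< i<n)))
                     (proj₁ (β∈U (fromℕ< i<n)))
      where i<n = subst (i <_) (length-toList β) i<

-- Permutations and their keys

toList-unique : ∀ {n} (v : Vec ℕ n) → (∀ i j → lookup v i ≡ lookup v j → i ≡ j) → Unique (toList v)
toList-unique []ᵥ _ = []
toList-unique (x ∷ᵥ v) inj =
  toList-All v (λ i eq → case (inj fzero (fsuc i) eq)) ∷ toList-unique v (λ i j eq → fsuc-injective (inj (fsuc i) (fsuc j) eq))
  where
    case : ∀ {i} → fzero ≢ fsuc i
    case ()

at-toList : ∀ {n} (v : Vec ℕ n) {q} (q<n : q < n) → at (toList v) q ≡ lookup v (fromℕ< q<n)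
at-toList v q<n = trans (cong (at (toList v)) (sym (toℕ-fromℕ< q<n))) (at-lookup v (fromℕ< q<n))

module Permutation {n} {π : Vec ℕ n} (perm : IsPerm n π) where

  entries : All (InRange n) (toList π)
  entries = toList-All π (proj₁ perm)

  unique : Unique (toList π)
  unique = toList-unique π (proj₂ perm)

  length≡n : length (toList π) ≡ n
  length≡n = length-toList π

  at-inRange : ∀ {q} → q < n → InRange n (at (toList π) q)
  at-inRange q<n = All.lookup entries (at-∈ (toList π) (subst (_ <_) (sym length≡n) q<n))

  at-injective : ∀ {q q′} → q < n → q′ < n → at (toList π) q ≡ at (toList π) q′ → q ≡ q′
  at-injective q<n q′<n = unique⇒at-injective unique (subst (_ <_) (sym length≡n) q<n) (subst (_ <_) (sym length≡n) q′<n)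

  surjective : ∀ {x} → InRange n x → x ∈ toList π
  surjective {x} x-range with x ∈? toList π
  ... | yes x∈ = x∈
  ... | no x∉ = ⊥-elim (<-irrefl refl (subst₂ (λ a b → suc a ≤ b) (length-toList π) (length-applyUpTo suc n)
                  (unique-⊆⇒length-≤ (Allₚ.¬Any⇒All¬ _ x∉ ∷ unique) x∷π⊆range)))
    where
      x∷π⊆range : x ∷ toList π ⊆ range n
      x∷π⊆range (here refl) = ∈-range⁺ n x-range
      x∷π⊆range (there y∈) = ∈-range⁺ n (All.lookup entries y∈)

  key-isKey : ∀ lam → IsKey n lam (keyColumn lam π)
  key-isKey lam = record
    { increasing = λ k → isort-increasing (Uniqueₚ.take⁺ (c k) unique)
    ; entries = λ k → All.tabulate (λ x∈ → All.lookup entries (∈-take⁻ (c k) (toList π) (∈-isort⁻ _ x∈)))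
    ; nested = λ k x∈ → ∈-isort⁺ _ (take-⊆-take (toList π) (countAtLeast-antitone (toList lam) (n≤1+n (suc k))) (∈-isort⁻ _ x∈))
    ; length≡ = λ k → begin
        length (isort (take (c k) (toList π)))  ≡⟨ length-isort (take (c k) (toList π)) ⟩
        length (take (c k) (toList π))          ≡⟨ length-take (c k) (toList π) ⟩
        c k ⊓ length (toList π)                 ≡⟨ cong (c k ⊓_) (length-toList π) ⟩
        c k ⊓ n                                 ≡⟨ m≤n⇒m⊓n≡m (colLength-≤ lam (suc k)) ⟩
        c k                                     ∎
    }
    where
      open ≡-Reasoning
      c : ℕ → ℕ
      c k = colLength lam (suc k)

  position : ∀ {x} → InRange n x → ∃ λ q → q < n × at (toList π) q ≡ x
  position x-range with ∈⇒at (toList π) (surjective x-range)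
  ... | q , q< , eq = q , subst (q <_) length≡n q< , eq

countAtLeast-pos : ∀ {j} ls → 0 < countAtLeast j ls → ∃ λ l → l ∈ ls × j ≤ l
countAtLeast-pos {j} (l ∷ ls) pos with j ≤? l
... | yes j≤l = l , here refl , j≤l
... | no j≰l with countAtLeast-pos ls (subst (0 <_) (countAtLeast-∷-> ls (≰⇒> j≰l)) pos)
...   | l′ , l′∈ , j≤l′ = l′ , there l′∈ , j≤l′

InR⇒colLength : ∀ {n} (lam : Vec ℕ n) {t} → InR lam t → ∃ λ k → k < numCols lam × colLength lam (suc k) ≡ t
InR⇒colLength lam (_ , _ , zero , () , _)
InR⇒colLength lam (1≤t , _ , suc k , _ , length≡t) with countAtLeast-pos (toList lam) (subst (1 ≤_) (sym length≡t) 1≤t)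
... | l , l∈ , k<l = k , ≤-trans k<l (All.lookup (≤-foldr-⊔ (toList lam)) l∈) , length≡t

keyColumns⇒prefixes : ∀ {n} {lam π π′ : Vec ℕ n} → (∀ {j} → j < numCols lam → keyColumn lam π j ≡ keyColumn lam π′ j) →
  ∀ {t x} → InR lam t → x ∈ take t (toList π) → x ∈ take t (toList π′)
keyColumns⇒prefixes {lam = lam} {π} {π′} keys {x = x} t∈R x∈ with InR⇒colLength lam t∈R
... | k , k<w , refl = ∈-isort⁻ _ (subst (x ∈_) (keys k<w) (∈-isort⁺ _ x∈))

InS-at-< : ∀ {n} {lam π : Vec ℕ n} → InS n lam π → ∀ {q} → suc q < n → ¬ InR lam (suc q) →
  at (toList π) q < at (toList π) (suc q)
InS-at-< {lam = lam} {π} (_ , increasing) {q} 1+q<n q+1∉R =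
  subst₂ _<_ (sym (at-toList π q<n)) (sym (at-toList π 1+q<n))
    (increasing (fromℕ< q<n) (fromℕ< 1+q<n) (trans (toℕ-fromℕ< 1+q<n) (cong suc (sym (toℕ-fromℕ< q<n))))
      (λ r → q+1∉R (subst (λ z → InR lam (suc z)) (toℕ-fromℕ< q<n) r)))
  where
    q<n = <-trans (n<1+n q) 1+q<n

module PrefixRecovery {n} {lam π π′ : Vec ℕ n} (π∈S : InS n lam π) (π′∈S : InS n lam π′)
  (prefixes : ∀ {t x} → InR lam t → x ∈ take t (toList π) → x ∈ take t (toList π′)) where

  private
    module P = Permutation {π = π} (proj₁ π∈S)
    module P′ = Permutation {π = π′} (proj₁ π′∈S)
    σ = toList π
    σ′ = toList π′

  -- Were x = π_p below π′_p, then π′ would keep increasing past x up to the end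
  -- of the carrel of p, where the prefix sets of π and π′ coincide, so x would
  -- never occur in π′.
  not-below : ∀ {p} → p < n → (∀ {q} → q < p → at σ q ≡ at σ′ q) → ¬ (at σ p < at σ′ p)
  not-below {p} p<n agree x<σ′p = reach (n ∸ suc p) p (m+[n∸m]≡n p<n) ≤-refl (avoid₀ , x<σ′p)
    where
      x = at σ p

      Avoids : ℕ → Set
      Avoids s = (∀ {q} → q ≤ s → at σ′ q ≢ x) × x < at σ′ s

      avoid₀ : ∀ {q} → q ≤ p → at σ′ q ≢ x
      avoid₀ {q} q≤p eq with m≤n⇒m<n∨m≡n q≤p
      ... | inj₁ q<p = <-irrefl (P.at-injective (<-trans q<p p<n) p<n (trans (agree q<p) eq)) q<p
      ... | inj₂ refl = <-irrefl (sym eq) x<σ′p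

      step : ∀ {s} → p ≤ s → suc s < n → Avoids s → Avoids (suc s)
      step {s} p≤s 1+s<n (avoid , x<σ′s) = avoid′ , x<σ′[1+s]
        where
          same-carrel : ¬ InR lam (suc s)
          same-carrel s+1∈R
            with ∈-take⇒at (suc s) σ′ (prefixes s+1∈R (at-∈-take σ (s≤s p≤s) (subst (p <_) (sym P.length≡n) p<n)))
          ... | q , q<1+s , eq = avoid (≤-pred q<1+s) eq
          x<σ′[1+s] : x < at σ′ (suc s)
          x<σ′[1+s] = <-trans x<σ′s (InS-at-< {lam = lam} {π′} π′∈S 1+s<n same-carrel)
          avoid′ : ∀ {q} → q ≤ suc s → at σ′ q ≢ x
          avoid′ q≤1+s eq with m≤n⇒m<n∨m≡n q≤1+s
          ... | inj₁ q<1+s = avoid (≤-pred q<1+s) eq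
          ... | inj₂ refl = <-irrefl (sym eq) x<σ′[1+s]

      reach : ∀ d s → suc s + d ≡ n → p ≤ s → Avoids s → ⊥
      reach zero s 1+s≡n _ (avoid , _) with P′.position (P.at-inRange p<n)
      ... | q , q<n , eq = avoid (≤-pred (subst (q <_) (trans (sym 1+s≡n) (+-identityʳ (suc s))) q<n)) eq
      reach (suc d) s 1+s+1+d≡n p≤s avoids =
        reach d (suc s) (trans (sym (+-suc (suc s) d)) 1+s+1+d≡n) (m≤n⇒m≤1+n p≤s) (step p≤s 1+s<n avoids)
        where
          1+s<n : suc s < n
          1+s<n = subst (suc s <_) 1+s+1+d≡n (m<m+n (suc s) (s≤s z≤n))

keyColumns-injective : ∀ {n} {lam π π′ : Vec ℕ n} → InS n lam π → InS n lam π′ →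
  (∀ {j} → j < numCols lam → keyColumn lam π j ≡ keyColumn lam π′ j) → π ≡ π′
keyColumns-injective {n} {lam} {π} {π′} π∈S π′∈S keys =
  trans (sym (cast-is-id refl π)) (toList-injective refl π π′
    (at-ext (toList π) (toList π′) (trans (length-toList π) (sym (length-toList π′)))
      (λ q< → agree n ≤-refl (subst (_ <_) (length-toList π) q<))))
  where
    module R = PrefixRecovery {lam = lam} π∈S π′∈S (keyColumns⇒prefixes {lam = lam} {π} {π′} keys)
    module R′ = PrefixRecovery {lam = lam} π′∈S π∈S (keyColumns⇒prefixes {lam = lam} {π′} {π} (λ j< → sym (keys j<)))
    agree : ∀ p → p ≤ n → ∀ {q} → q < p → at (toList π) q ≡ at (toList π′) q
    agree (suc p) p<n {q} q<1+p with m≤n⇒m<n∨m≡n (≤-pred q<1+p)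
    ... | inj₁ q<p = agree p (<⇒≤ p<n) q<p
    ... | inj₂ refl = ≤-antisym (≮⇒≥ (R′.not-below p<n (λ q< → sym (agree p (<⇒≤ p<n) q<))))
                                (≮⇒≥ (R.not-below p<n (agree p (<⇒≤ p<n))))

-- Weight sums

leqList-refl : ∀ xs → True (leqList xs xs)
leqList-refl [] = _
leqList-refl (x ∷ xs) = ∧⁺ (≤⇒≤ᵇ (≤-refl {x})) (leqList-refl xs)

leqList-antisym : ∀ xs ys → length xs ≡ length ys → True (leqList xs ys) → True (leqList ys xs) → xs ≡ ys
leqList-antisym [] [] _ _ _ = refl
leqList-antisym (x ∷ xs) (y ∷ ys) len xs≤ys ys≤xs =
  cong₂ _∷_ (≤-antisym (≤ᵇ⇒≤ x y (proj₁ (∧⁻ xs≤ys))) (≤ᵇ⇒≤ y x (proj₁ (∧⁻ ys≤xs))))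
         (leqList-antisym xs ys (suc-injective len) (proj₂ (∧⁻ {x ≤ᵇ y} xs≤ys)) (proj₂ (∧⁻ {y ≤ᵇ x} ys≤xs)))

leqList-applyUpTo : ∀ (f : ℕ → ℕ) m {ys} → AllPairs _<_ ys → All (m ≤_) ys → (∀ i → f i ≤ m + i) →
  True (leqList (applyUpTo f (length ys)) ys)
leqList-applyUpTo f m {[]} _ _ _ = _
leqList-applyUpTo f m {y ∷ ys} (y<ys ∷ ys↑) (m≤y ∷ m≤ys) f≤ =
  ∧⁺ (≤⇒≤ᵇ (≤-trans (f≤ 0) (subst (_≤ y) (sym (+-identityʳ m)) m≤y)))
     (leqList-applyUpTo (λ i → f (suc i)) (suc m) ys↑ (All.map (λ y<z → ≤-trans (s≤s m≤y) y<z) y<ys)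
       (λ i → subst (f (suc i) ≤_) (+-suc m i) (f≤ (suc i))))

rightKeyBelow⁻ : ∀ {n lam π T} → True (rightKeyBelow n lam π T) →
  ∀ {j} → j < numCols lam → True (leqList (rightKeyColumn n T j) (keyColumn lam π j))
rightKeyBelow⁻ {n} {lam} {π} {T} below =
  Allₚ.applyUpTo⁻ (λ k → k) (numCols lam) (Allₚ.all⁺ (λ j → leqList (rightKeyColumn n T j) (keyColumn lam π j)) _ below)

rightKeyBelow⁺ : ∀ {n lam π T} → (∀ {j} → j < numCols lam → True (leqList (rightKeyColumn n T j) (keyColumn lam π j))) →
  True (rightKeyBelow n lam π T)
rightKeyBelow⁺ {n} {lam} {π} {T} below =
  Allₚ.all⁻ (λ j → leqList (rightKeyColumn n T j) (keyColumn lam π j)) (Allₚ.applyUpTo⁺₁ (λ k → k) (numCols lam) below)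

∈-rowBoundSet⁻ : ∀ {n lam β T} → T ∈ rowBoundSet n lam β → IsTableau n lam T
∈-rowBoundSet⁻ {n} {lam} {β} T∈ = ∈-𝒯⁻ n lam (proj₁ (∈-filter⁻ (λ T → T? (rowBounded (toList β) T)) {xs = 𝒯 n lam} T∈))

∈-demazureSet⁻ : ∀ {n lam π T} → T ∈ demazureSet n lam π → IsTableau n lam T × True (rightKeyBelow n lam π T)
∈-demazureSet⁻ {n} {lam} {π} T∈ with ∈-filter⁻ (λ T → T? (rightKeyBelow n lam π T)) {xs = 𝒯 n lam} T∈
... | T∈𝒯 , below = ∈-𝒯⁻ n lam T∈𝒯 , below

∈-demazureSet⁺ : ∀ {n lam π T} → IsTableau n lam T → True (rightKeyBelow n lam π T) → T ∈ demazureSet n lam π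
∈-demazureSet⁺ {n} {lam} {π} tab below = ∈-filter⁺ (λ T → T? (rightKeyBelow n lam π T)) (∈-𝒯⁺ n lam tab) below

weightSum-witness : ∀ n S θ → 0 < weightSum n S θ → ∃ λ T → T ∈ S × content n T ≡ θ
weightSum-witness n S θ pos with filterᵇ (λ T → ⌊ ≡-dec _≟_ (content n T) θ ⌋) S in eq
... | T ∷ _ with ∈-filter⁻ (λ T → T? ⌊ ≡-dec _≟_ (content n T) θ ⌋) {xs = S} (subst (T ∈_) (sym eq) (here refl))
...   | T∈S , same = T , T∈S , toWitness same

≈ₚ-content : ∀ {n S S′ T} → weightSum n S ≈ₚ weightSum n S′ → T ∈ S →
  ∃ λ T′ → T′ ∈ S′ × content n T′ ≡ content n T
≈ₚ-content {n} {S} {S′} {T} same T∈S = weightSum-witness n S′ (content n T) (subst (0 <_) (same (content n T)) present)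
  where
    present : 0 < weightSum n S (content n T)
    present = filter-some (λ T′ → T? ⌊ ≡-dec _≟_ (content n T′) (content n T) ⌋) (lose T∈S (fromWitness refl))

weightSum-⊴ : ∀ {n} {lam mu : Vec ℕ n} {S S′} → IsPartition lam → IsPartition mu → superstandard lam ∈ S →
  (∀ {T} → T ∈ S′ → IsTableau n mu T) → weightSum n S ≈ₚ weightSum n S′ → lam ⊴ mu
weightSum-⊴ {lam = lam} lam-partition mu-partition T⁰∈S tableaux same with ≈ₚ-content same T⁰∈S
... | T′ , T′∈S′ , same-content =
  content-⊴-shape mu-partition (tableaux T′∈S′) (trans same-content (content-superstandard lam lam-partition))

weightSum-shape : ∀ {n} {lam mu : Vec ℕ n} {S S′} → IsPartition lam → IsPartition mu →
  superstandard lam ∈ S → superstandard mu ∈ S′ →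
  (∀ {T} → T ∈ S → IsTableau n lam T) → (∀ {T} → T ∈ S′ → IsTableau n mu T) →
  weightSum n S ≈ₚ weightSum n S′ → lam ≡ mu
weightSum-shape lam-partition mu-partition T⁰∈S T⁰∈S′ tableaux tableaux′ same =
  ⊴-antisym (weightSum-⊴ lam-partition mu-partition T⁰∈S tableaux′ same)
            (weightSum-⊴ mu-partition lam-partition T⁰∈S′ tableaux (λ θ → sym (same θ)))

superstandard-∈-rowBoundSet : ∀ {n} (lam β : Vec ℕ n) → IsPartition lam → InU n β → superstandard lam ∈ rowBoundSet n lam β
superstandard-∈-rowBoundSet {n} lam β partition β∈U =
  ∈-filter⁺ (λ T → T? (rowBounded (toList β) T))
    (∈-𝒯⁺ n lam (KeyTableau.tableauOf-isTableau (superstandard-isKey lam) partition))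
    (superstandard-rowBounded lam β partition β∈U)

module _ {n} (lam : Vec ℕ n) (partition : IsPartition lam) where

  key-∈-demazureSet : ∀ {C π} → IsKey n lam C → (∀ {j} → j < numCols lam → True (leqList (C j) (keyColumn lam π j))) →
    tableauOf C lam ∈ demazureSet n lam π
  key-∈-demazureSet {C} {π} key C≤π = ∈-demazureSet⁺ {n} {lam} {π} tab (rightKeyBelow⁺ {n} {lam} {π} {tableauOf C lam} (λ j<w →
      subst (λ c → True (leqList c _)) (sym (rightKeyColumn-key key partition tab (λ {k} _ → column-tableauOf partition k) j<w)) (C≤π j<w)))
    where
      open KeyTableau key
      tab = tableauOf-isTableau partition

  superstandard-∈-demazureSet : ∀ {π} → InS n lam π → superstandard lam ∈ demazureSet n lam π
  superstandard-∈-demazureSet {π} π∈S = key-∈-demazureSet (superstandard-isKey lam) λ {j} _ →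
    subst (λ c → True (leqList (range c) (keyColumn lam π j))) (IsKey.length≡ key j)
      (leqList-applyUpTo suc 1 (IsKey.increasing key j) (All.map proj₁ (IsKey.entries key j)) (λ _ → ≤-refl))
    where key = Permutation.key-isKey (proj₁ π∈S) lam

  demazure-keys-≤ : ∀ {π π′} → InS n lam π → InS n lam π′ → d n lam π ≈ₚ d n lam π′ →
    ∀ {j} → j < numCols lam → True (leqList (keyColumn lam π j) (keyColumn lam π′ j))
  demazure-keys-≤ {π} {π′} π∈S π′∈S same {j} j<w =
    via-tableau (≈ₚ-content same (key-∈-demazureSet key (λ _ → leqList-refl (keyColumn lam π _))))
    where
      key = Permutation.key-isKey (proj₁ π∈S) lam
      via-tableau : (∃ λ T′ → T′ ∈ demazureSet n lam π′ × content n T′ ≡ content n (tableauOf (keyColumn lam π) lam)) →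
        True (leqList (keyColumn lam π j) (keyColumn lam π′ j))
      via-tableau (T′ , T′∈ , same-content) =
        subst (λ c → True (leqList c (keyColumn lam π′ j)))
          (rightKeyColumn-key key partition tab (key-rigid key partition tab same-content) j<w)
          (rightKeyBelow⁻ {n} {lam} {π′} {T′} below j<w)
        where
          T′∈𝒟 = ∈-demazureSet⁻ {n} {lam} {π′} T′∈
          tab = proj₁ T′∈𝒟
          below = proj₂ T′∈𝒟

  demazure-permutation : ∀ {π π′} → InS n lam π → InS n lam π′ → d n lam π ≈ₚ d n lam π′ → π ≡ π′
  demazure-permutation {π} {π′} π∈S π′∈S same = keyColumns-injective {lam = lam} π∈S π′∈S λ {j} j<w →
    leqList-antisym (keyColumn lam π j) (keyColumn lam π′ j)
      (trans (IsKey.length≡ (Permutation.key-isKey (proj₁ π∈S) lam) j)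
             (sym (IsKey.length≡ (Permutation.key-isKey (proj₁ π′∈S) lam) j)))
      (demazure-keys-≤ π∈S π′∈S same j<w) (demazure-keys-≤ π′∈S π∈S (λ θ → sym (same θ)) j<w)

rowBoundSum-shape : ∀ {n} (lam lam′ β β′ : Vec ℕ n) → IsPartition lam → IsPartition lam′ → InU n β → InU n β′ →
  s n lam β ≈ₚ s n lam′ β′ → lam ≡ lam′
rowBoundSum-shape {n} lam lam′ β β′ partition partition′ β∈U β′∈U =
  weightSum-shape partition partition′
    (superstandard-∈-rowBoundSet lam β partition β∈U) (superstandard-∈-rowBoundSet lam′ β′ partition′ β′∈U)
    (∈-rowBoundSet⁻ {n} {lam} {β}) (∈-rowBoundSet⁻ {n} {lam′} {β′})

demazure-injective : ∀ {n} (lam lam′ π π′ : Vec ℕ n) → IsPartition lam → IsPartition lam′ → InS n lam π → InS n lam′ π′ →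
  d n lam π ≈ₚ d n lam′ π′ → (lam ≡ lam′) × (π ≡ π′)
demazure-injective {n} lam lam′ π π′ partition partition′ π∈S π′∈S same
  with weightSum-shape partition partition′
         (superstandard-∈-demazureSet lam partition π∈S) (superstandard-∈-demazureSet lam′ partition′ π′∈S)
         (λ T∈ → proj₁ (∈-demazureSet⁻ {n} {lam} {π} T∈)) (λ T∈ → proj₁ (∈-demazureSet⁻ {n} {lam′} {π′} T∈)) same
... | refl = refl , demazure-permutation lam partition π∈S π′∈S same

proposition10p1 : ∀ {n : ℕ} → 1 ≤ n →
    (∀ (lam lam' β β' : Vec ℕ n) → IsPartition lam → IsPartition lam'
    → InU n β → InU n β' → s n lam β ≈ₚ s n lam' β' → lam ≡ lam')
    × (∀ (lam lam' π π' : Vec ℕ n) → IsPartition lam → IsPartition lam'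
    → InS n lam π → InS n lam' π' → d n lam π ≈ₚ d n lam' π'
    → (lam ≡ lam') × (π ≡ π'))
proposition10p1 _ = rowBoundSum-shape , demazure-injective
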